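{- Let $\overline{cg}(n,t,1)$ be the number, up to isomorphism, of complete games with $n$ players, $t$ equivalence classes and exactly one shift-maximal losing vector, and $\overline{cg}(n,\ast,1)=\sum_{t=1}^n\overline{cg}(n,t,1)$. Then (1) $\overline{cg}(n,\ast,1)=2^n-1$; (2) $\overline{cg}(n,t,1)=n$ if $t=1$, $\overline{cg}(n,t,1)=\binom{n+1}{2t-1}$ if $2\le t\le \frac n2+1$, and $\overline{cg}(n,t,1)=0$ otherwise.
   Context: A simple game on $N=\{1,\dots,n\}$ is a family $\mathcal W$ of subsets with $\emptyset\notin\mathcal W$, $N\in\mathcal W$, upward closed; isomorphism is a bijection of players preserving winning coalitions. Desirability: $i\succsim j$ iff for every $S\subseteq N\setminus\{i,j\}$, $S\cup\{j\}\in\mathcal W\Rightarrow S\cup\{i\}\in\mathcal W$; the game is complete if $\succsim$ is total, with equivalence classes $N_1,\dots,N_t$ ordered by strictly decreasing desirability, $n_h=|N_h|$. A vector $(m_1,\dots,m_t)$, $0\le m_h\le n_h$, is winning/losing according to whether coalitions with exactly $m_h$ members of each $N_h$ are winning/losing. $\tilde a\succeq\tilde b$ iff $\sum_{i\le k}a_i\ge\sum_{i\le k}b_i$ for all $k$; $\tilde a\succ\tilde b$ if also $\tilde a\neq\tilde b$. A shift-maximal losing vector is a losing vector $\tilde m$ such that every $\tilde m'\succ\tilde m$ is winning. -}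

module Defs where

open import Data.Bool using (Bool; true; false; if_then_else_)
open import Data.Nat using (ℕ; zero; suc; _≤_; _<ᵇ_; _∸_; _^_; _*_)
open import Data.Nat.ListAction using (sum)
open import Data.Fin using (Fin; toℕ; _≟_) renaming (_≤_ to _≤ᶠ_)
open import Data.Fin.Subset using (Subset; ⊥; ⊤; _⊆_; _∉_; _∪_; _∩_; ⁅_⁆; ∣_∣)
open import Data.Fin.Permutation using (Permutation′; _⟨$⟩ˡ_)
open import Data.Vec using (tabulate; lookup)
open import Data.List using (List; length; map)
open import Data.List.Relation.Unary.Any using (Any)
open import Data.List.Relation.Unary.All using (All)
open import Data.List.Relation.Unary.AllPairs using (AllPairs)
open import Data.Product using (Σ; ∃; ∃-syntax; _×_)
open import Relation.Binary.PropositionalEquality using (_≡_)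
open import Relation.Nullary using (¬_; ⌊_⌋)
open import Function.Bundles using (_⇔_)

record SimpleGame (n : ℕ) : Set where
  field
    W         : Subset n → Bool
    empty-los : W ⊥ ≡ false
    grand-win : W ⊤ ≡ true
    upward    : ∀ S T → S ⊆ T → W S ≡ true → W T ≡ true
open SimpleGame public

-- Image of a coalition under a bijection π of the players:
-- j ∈ img π S  iff  π⁻¹ j ∈ S.
img : ∀ {n} → Permutation′ n → Subset n → Subset n
img π S = tabulate (λ j → lookup S (π ⟨$⟩ˡ j))

Isomorphic : ∀ {n} → SimpleGame n → SimpleGame n → Set
Isomorphic G H = Σ (Permutation′ _) λ π → ∀ S → W H (img π S) ≡ W G S

Desirable : ∀ {n} → SimpleGame n → Fin n → Fin n → Set
Desirable G i j = ∀ S → i ∉ S → j ∉ S →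
  W G (S ∪ ⁅ j ⁆) ≡ true → W G (S ∪ ⁅ i ⁆) ≡ true

-- A map c : N → Fin t describing a complete game with t equivalence
-- classes N_1,…,N_t (class index 0 = most desirable): c is onto and
-- i ≿ j  iff  c i ≤ c j.  Such a c exists iff ≿ is total (game is
-- complete) with exactly t classes, and it is then unique.
IsClassMap : ∀ {n} → SimpleGame n → (t : ℕ) → (Fin n → Fin t) → Set
IsClassMap G t c =
  (∀ h → ∃[ i ] c i ≡ h) × (∀ i j → Desirable G i j ⇔ (c i ≤ᶠ c j))

classSet : ∀ {n t} → (Fin n → Fin t) → Fin t → Subset n
classSet c h = tabulate (λ i → ⌊ c i ≟ h ⌋)

classSize : ∀ {n t} → (Fin n → Fin t) → Fin t → ℕ
classSize c h = ∣ classSet c h ∣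

profile : ∀ {n t} → (Fin n → Fin t) → Subset n → Fin t → ℕ
profile c S h = ∣ S ∩ classSet c h ∣

ValidVec : ∀ {n t} → (Fin n → Fin t) → (Fin t → ℕ) → Set
ValidVec c m = ∀ h → m h ≤ classSize c h

WinningVec LosingVec : ∀ {n t} → SimpleGame n → (Fin n → Fin t) → (Fin t → ℕ) → Set
WinningVec G c m = ∀ S → (∀ h → profile c S h ≡ m h) → W G S ≡ true
LosingVec  G c m = ∀ S → (∀ h → profile c S h ≡ m h) → W G S ≡ false

-- Prefix sums  Σ_{i<k} a_i  (0-indexed; i.e. the sum of the first k entries).
prefixSum : ∀ {t} → (Fin t → ℕ) → ℕ → ℕ
prefixSum a k = sum (Data.List.tabulate (λ i → if toℕ i <ᵇ k then a i else 0))

_⪰_ : ∀ {t} → (Fin t → ℕ) → (Fin t → ℕ) → Set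
a ⪰ b = ∀ k → prefixSum b k ≤ prefixSum a k

_≻_ : ∀ {t} → (Fin t → ℕ) → (Fin t → ℕ) → Set
a ≻ b = (a ⪰ b) × ¬ (∀ h → a h ≡ b h)

ShiftMaxLosing : ∀ {n t} → SimpleGame n → (Fin n → Fin t) → (Fin t → ℕ) → Set
ShiftMaxLosing G c m =
  ValidVec c m × LosingVec G c m ×
  (∀ m′ → ValidVec c m′ → m′ ≻ m → WinningVec G c m′)

CompleteOneSML : ∀ {n} → ℕ → SimpleGame n → Set
CompleteOneSML t G = Σ (Fin _ → Fin t) λ c → IsClassMap G t c ×
  Σ (Fin t → ℕ) λ m → ShiftMaxLosing G c m ×
    (∀ m′ → ShiftMaxLosing G c m′ → ∀ h → m′ h ≡ m h)

-- "The number of games with property P, up to isomorphism, is k":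
-- there is a list of k pairwise non-isomorphic games with P such that
-- every game with P is isomorphic to one in the list.

NumIsoClasses : (n : ℕ) → (SimpleGame n → Set) → ℕ → Set
NumIsoClasses n P k = Σ (List (SimpleGame n)) λ Gs →
  (length Gs ≡ k) × All P Gs ×
  AllPairs (λ G H → ¬ Isomorphic G H) Gs ×
  (∀ G → P G → Any (Isomorphic G) Gs)

-- A complete game with a unique shift-maximal losing vector m is determined by its class sizes
-- σ = (n₁,…,nₜ) and m: a coalition wins iff m does not dominate its vector. Indeed winning is
-- monotone for ⪰ (move members one at a time to better classes, using completeness), and a
-- losing coalition of maximal weight above a given losing one has a shift-maximal vector, which
-- must be m. Conversely the domination game of (σ, m) is complete with t classes and unique
-- shift-maximal losing vector m iff 0 ≤ m₁ < n₁, 1 ≤ mₕ < nₕ for 1 < h < t and 1 ≤ mₜ ≤ nₜ.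
-- Subtracting these lower bounds from m and σ - m turns the pairs (σ, m) into compositions of
-- n - 2t + 2 (of n - 1 when t = 1) into 2t parts, of which there are C(n + 1, 2t - 1) (resp. n).
-- Summing over t, n + Σₜ₌₂ C(n + 1, 2t - 1) is n plus the odd binomial coefficients of row
-- n + 1 other than C(n + 1, 1), that is n + 2ⁿ - (n + 1) = 2ⁿ - 1.

module Submission where

open import Defs
open import Data.Bool using (Bool; true; false; _∧_; _∨_; not; if_then_else_)
open import Data.Bool.Properties
  using (∧-zeroʳ; ∧-identityʳ; ∧-comm; ∧-assoc; ∨-zeroʳ; ∨-identityʳ; ∧-conicalˡ; ∧-conicalʳ; not-injective; T-≡)
  renaming (_≟_ to _≟ᵇ_)
open import Data.Empty using (⊥-elim)
open import Data.Fin using (Fin; zero; suc; toℕ; _≟_; fromℕ; fromℕ<; inject₁; _↑ˡ_; _↑ʳ_; splitAt)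
open import Data.Fin.Permutation using (Permutation′; _⟨$⟩ʳ_; _⟨$⟩ˡ_; inverseˡ; inverseʳ; flip; transpose; lift₀; _∘ₚ_; id)
open import Data.Fin.Properties
  using (all?; any?; toℕ<n; toℕ-fromℕ; toℕ-fromℕ<; toℕ-inject₁; toℕ-injective; splitAt⁻¹-↑ˡ; splitAt⁻¹-↑ʳ; splitAt-↑ˡ; splitAt-↑ʳ)
open import Data.Fin.Subset using (Subset; ∣_∣; _∩_; _∪_; ⁅_⁆; _⊆_; _∉_)
import Data.Fin.Subset as Subset
open import Data.Fin.Subset.Properties using (∣p∩q∣≤∣q∣)
open import Data.List using (List; []; _∷_; _++_; map; length; filter; allFin)
open import Data.List.Extrema.Nat using (argmax; argmax-all; f[xs]≤f[argmax])
open import Data.List.Membership.Propositional using (_∈_)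
open import Data.List.Membership.Propositional.Properties using (∈-filter⁺; ∈-allFin; ∈-map⁺; ∈-map⁻; ∈-++⁺ˡ; ∈-++⁺ʳ)
open import Data.List.Properties using (length-map; length-++)
open import Data.List.Relation.Unary.All as All using (All)
import Data.List.Relation.Unary.All.Properties as All
open import Data.List.Relation.Unary.AllPairs as AllPairs using (AllPairs)
import Data.List.Relation.Unary.AllPairs.Properties as AllPairs
open import Data.List.Relation.Unary.Any as Any using (Any; here)
import Data.List.Relation.Unary.Any.Properties as Any
open import Data.Nat using (ℕ; zero; suc; _+_; _∸_; _*_; _^_; _≤_; _<_; z≤n; s≤s; _<ᵇ_; _≤?_; _<?_) renaming (_≟_ to _≟ℕ_)
open import Data.Nat.Combinatorics using (_C_; nC1≡n; nCn≡1; k>n⇒nCk≡0; nCk+nC[k+1]≡[n+1]C[k+1])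
open import Data.Nat.Properties hiding (_≟_)
open import Algebra.Properties.CommutativeMonoid.Sum +-0-commutativeMonoid using (sum-syntax; sum-cong-≗; ∑-distrib-+; ∑-permute)
open import Data.Nat.Tactic.RingSolver using (solve-∀)
open import Data.Product using (Σ; ∃; ∃-syntax; _×_; _,_; proj₁; proj₂)
open import Data.Sum using (_⊎_; inj₁; inj₂)
open import Data.Vec using ([]; _∷_; lookup; tabulate)
open import Data.Vec.Functional using () renaming (_∷_ to _∷ᶠ_; _++_ to _++ᶠ_)
open import Data.Vec.Properties
  using (lookup∘tabulate; lookup-zipWith; lookup-replicate; []=⇒lookup; lookup⇒[]=; tabulate∘lookup; tabulate-cong)
open import Function.Bundles using (Equivalence; mk⇔)
open import Relation.Binary.PropositionalEquality
open import Relation.Nullary using (¬_; Dec; yes; no; does; ⌊_⌋)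
open import Relation.Nullary.Decidable using (dec-true; dec-false; does-⇔; isYes≗does; map′; _×-dec_)
open import Relation.Unary using (Decidable)

bit : Bool → ℕ
bit true  = 1
bit false = 0

count : ∀ {n} → (Fin n → Bool) → ℕ
count {n} p = ∑[ i < n ] bit (p i)

_⊆ᵇ_ : ∀ {n} → (Fin n → Bool) → (Fin n → Bool) → Set
p ⊆ᵇ q = ∀ i → p i ≡ true → q i ≡ true

count-cong : ∀ {n} {p q : Fin n → Bool} → (∀ i → p i ≡ q i) → count p ≡ count q
count-cong {n} p≗q = sum-cong-≗ {n} (λ i → cong bit (p≗q i))

count-mono : ∀ {n} {p q : Fin n → Bool} → p ⊆ᵇ q → count p ≤ count q
count-mono {zero}  p⊆q = z≤n
count-mono {suc n} p⊆q = +-mono-≤ (bit-mono (p⊆q zero)) (count-mono (λ i → p⊆q (suc i)))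
  where
  bit-mono : ∀ {a b} → (a ≡ true → b ≡ true) → bit a ≤ bit b
  bit-mono {false} _   = z≤n
  bit-mono {true}  a⇒b rewrite a⇒b refl = ≤-refl

count-none : ∀ {n} {p : Fin n → Bool} → (∀ i → p i ≡ false) → count p ≡ 0
count-none {zero}  _ = refl
count-none {suc n} none rewrite none zero = count-none (λ i → none (suc i))

count-all : ∀ {n} {p : Fin n → Bool} → (∀ i → p i ≡ true) → count p ≡ n
count-all {zero}  _ = refl
count-all {suc n} all rewrite all zero = cong suc (count-all (λ i → all (suc i)))

count-pos : ∀ {n} (p : Fin n → Bool) → 0 < count p → ∃[ i ] p i ≡ true
count-pos {suc n} p pos with p zero in p0
... | true  = zero , p0
... | false = let i , pi = count-pos (λ i → p (suc i)) pos in suc i , pi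

count-split : ∀ {n} (p q : Fin n → Bool) →
  count p ≡ count (λ i → p i ∧ q i) + count (λ i → p i ∧ not (q i))
count-split {n} p q =
  trans (sum-cong-≗ {n} (λ i → bit-split (p i) (q i))) (∑-distrib-+ (λ i → bit (p i ∧ q i)) (λ i → bit (p i ∧ not (q i))))
  where
  bit-split : ∀ a b → bit a ≡ bit (a ∧ b) + bit (a ∧ not b)
  bit-split false _     = refl
  bit-split true  false = refl
  bit-split true  true  = refl

count-at : ∀ {n} (p : Fin n → Bool) (j : Fin n) → count (λ i → p i ∧ does (i ≟ j)) ≡ bit (p j)
count-at {suc n} p zero = trans (cong (bit (p zero ∧ true) +_) (count-none (λ i → ∧-zeroʳ (p (suc i)))))
                                (trans (+-identityʳ _) (cong bit (∧-identityʳ (p zero))))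
count-at {suc n} p (suc j) =
  trans (cong (λ b → bit b + count (λ i → p (suc i) ∧ does (i ≟ j))) (∧-zeroʳ (p zero))) (count-at (λ i → p (suc i)) j)

count-remove : ∀ {n} (p : Fin n → Bool) (j : Fin n) →
  count p ≡ count (λ i → p i ∧ not (does (i ≟ j))) + bit (p j)
count-remove p j = trans (count-split p (λ i → does (i ≟ j))) (trans (+-comm (count at) (count away)) (cong (count away +_) (count-at p j)))
  where
  at away : _ → Bool
  at i = p i ∧ does (i ≟ j)
  away i = p i ∧ not (does (i ≟ j))

∧-monoˡ-⊆ᵇ : ∀ {n} {p q : Fin n → Bool} (r : Fin n → Bool) → p ⊆ᵇ q → (λ i → p i ∧ r i) ⊆ᵇ (λ i → q i ∧ r i)
∧-monoˡ-⊆ᵇ {p = p} r p⊆q i e with p i in pᵢ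
... | true rewrite p⊆q i pᵢ = e

count-strict : ∀ {n} {p q : Fin n → Bool} (j : Fin n) → p ⊆ᵇ q → q j ≡ true → p j ≡ false →
  suc (count p) ≤ count q
count-strict {p = p} {q} j p⊆q qj pj rewrite count-remove p j | count-remove q j | pj | qj =
  subst₂ _≤_ (cong suc (sym (+-identityʳ _))) (+-comm 1 _) (s≤s (count-mono (∧-monoˡ-⊆ᵇ _ p⊆q)))

count-pos⁺ : ∀ {n} (p : Fin n → Bool) j → p j ≡ true → 0 < count p
count-pos⁺ p j pⱼ rewrite count-remove p j | pⱼ = <-≤-trans (s≤s z≤n) (m≤n+m 1 _)

count-permute : ∀ {n} (π : Permutation′ n) (p : Fin n → Bool) → count (λ i → p (π ⟨$⟩ʳ i)) ≡ count p
count-permute π p = sym (∑-permute (λ i → bit (p i)) π)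

prefixSum-cong : ∀ {t} {a b : Fin t → ℕ} → (∀ h → a h ≡ b h) → ∀ k → prefixSum a k ≡ prefixSum b k
prefixSum-cong {zero}  a≗b k       = refl
prefixSum-cong {suc t} a≗b zero    = cong (0 +_) (prefixSum-cong (λ h → a≗b (suc h)) 0)
prefixSum-cong {suc t} a≗b (suc k) = cong₂ _+_ (a≗b zero) (prefixSum-cong (λ h → a≗b (suc h)) k)

prefixSum-zero : ∀ {t} (a : Fin t → ℕ) → prefixSum a 0 ≡ 0
prefixSum-zero {zero}  a = refl
prefixSum-zero {suc t} a = prefixSum-zero (λ h → a (suc h))

prefixSum-step : ∀ {t} (a : Fin t → ℕ) (h : Fin t) → prefixSum a (suc (toℕ h)) ≡ prefixSum a (toℕ h) + a h
prefixSum-step a zero    = trans (cong (a zero +_) (prefixSum-zero (λ h → a (suc h))))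
                                 (trans (+-comm (a zero) 0) (cong (_+ a zero) (sym (prefixSum-zero a))))
prefixSum-step a (suc h) = trans (cong (a zero +_) (prefixSum-step (λ h → a (suc h)) h)) (sym (+-assoc (a zero) _ _))

prefixSum-beyond : ∀ {t} (a : Fin t → ℕ) {k} → t ≤ k → prefixSum a k ≡ prefixSum a t
prefixSum-beyond {zero}  a t≤k       = refl
prefixSum-beyond {suc t} a (s≤s t≤k) = cong (a zero +_) (prefixSum-beyond (λ h → a (suc h)) t≤k)

prefixSum-mono : ∀ {t} {a b : Fin t → ℕ} → (∀ h → a h ≤ b h) → ∀ k → prefixSum a k ≤ prefixSum b k
prefixSum-mono {zero}  a≤b k       = z≤n
prefixSum-mono {suc t} a≤b zero    = prefixSum-mono (λ h → a≤b (suc h)) 0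
prefixSum-mono {suc t} a≤b (suc k) = +-mono-≤ (a≤b zero) (prefixSum-mono (λ h → a≤b (suc h)) k)

prefixSum-+ : ∀ {t} (a b : Fin t → ℕ) k → prefixSum (λ h → a h + b h) k ≡ prefixSum a k + prefixSum b k
prefixSum-+ {zero}  a b k       = refl
prefixSum-+ {suc t} a b zero    = prefixSum-+ (λ h → a (suc h)) (λ h → b (suc h)) 0
prefixSum-+ {suc t} a b (suc k) = begin
  a zero + b zero + prefixSum (λ h → a (suc h) + b (suc h)) k
    ≡⟨ cong (a zero + b zero +_) (prefixSum-+ (λ h → a (suc h)) (λ h → b (suc h)) k) ⟩
  a zero + b zero + (prefixSum (λ h → a (suc h)) k + prefixSum (λ h → b (suc h)) k)
    ≡⟨ +-interchange (a zero) (b zero) _ _ ⟩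
  a zero + prefixSum (λ h → a (suc h)) k + (b zero + prefixSum (λ h → b (suc h)) k) ∎
  where
  open ≡-Reasoning
  +-interchange : ∀ w x y z → w + x + (y + z) ≡ w + y + (x + z)
  +-interchange = solve-∀

prefixSum-at : ∀ {t} (j : Fin t) k → prefixSum (λ h → bit (does (j ≟ h))) k ≡ bit (toℕ j <ᵇ k)
prefixSum-at {suc t} zero zero    = prefixSum-zero {t} (λ _ → 0)
prefixSum-at {suc t} zero (suc k) = cong suc (prefixSum-null {t} k)
  where
  prefixSum-null : ∀ {t} k → prefixSum {t} (λ _ → 0) k ≡ 0
  prefixSum-null {zero}  k       = refl
  prefixSum-null {suc t} zero    = prefixSum-null {t} 0
  prefixSum-null {suc t} (suc k) = prefixSum-null {t} k
prefixSum-at (suc j) zero    = prefixSum-at j zero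
prefixSum-at (suc j) (suc k) = prefixSum-at j k

⪰-antisym : ∀ {t} {a b : Fin t → ℕ} → a ⪰ b → b ⪰ a → ∀ h → a h ≡ b h
⪰-antisym {a = a} {b} a⪰b b⪰a h = +-cancelˡ-≡ (prefixSum a (toℕ h)) _ _ (begin
  prefixSum a (toℕ h) + a h     ≡⟨ sym (prefixSum-step a h) ⟩
  prefixSum a (suc (toℕ h))     ≡⟨ same (suc (toℕ h)) ⟩
  prefixSum b (suc (toℕ h))     ≡⟨ prefixSum-step b h ⟩
  prefixSum b (toℕ h) + b h     ≡⟨ cong (_+ b h) (sym (same (toℕ h))) ⟩
  prefixSum a (toℕ h) + b h     ∎)
  where
  open ≡-Reasoning
  same : ∀ k → prefixSum a k ≡ prefixSum b k
  same k = ≤-antisym (b⪰a k) (a⪰b k)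

⪰-refl : ∀ {t} (a : Fin t → ℕ) → a ⪰ a
⪰-refl a k = ≤-refl

⪰-trans : ∀ {t} (a b d : Fin t → ℕ) → a ⪰ b → b ⪰ d → a ⪰ d
⪰-trans _ _ _ a⪰b b⪰d k = ≤-trans (b⪰d k) (a⪰b k)

-- Only the prefixes of length at most t carry information.
⪰-from-prefixes : ∀ {t} {a b : Fin t → ℕ} → (∀ (k : Fin (suc t)) → prefixSum b (toℕ k) ≤ prefixSum a (toℕ k)) → a ⪰ b
⪰-from-prefixes {t} {a} {b} a⪰b k with k ≤? t
... | yes k≤t = subst (λ k → prefixSum b k ≤ prefixSum a k) (toℕ-fromℕ< (s≤s k≤t)) (a⪰b (fromℕ< (s≤s k≤t)))
... | no  k≰t = subst₂ _≤_ (sym (prefixSum-beyond b t≤k)) (sym (prefixSum-beyond a t≤k))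
                       (subst (λ k → prefixSum b k ≤ prefixSum a k) (toℕ-fromℕ t) (a⪰b (fromℕ t)))
  where t≤k = <⇒≤ (≰⇒> k≰t)

_⪰?_ : ∀ {t} (a b : Fin t → ℕ) → Dec (a ⪰ b)
_⪰?_ {t} a b = map′ (⪰-from-prefixes {a = a} {b}) (λ a⪰b k → a⪰b (toℕ k))
  (all? (λ (k : Fin (suc t)) → prefixSum b (toℕ k) ≤? prefixSum a (toℕ k)))

∑-mono : ∀ {t} {f g : Fin t → ℕ} → (∀ i → f i ≤ g i) → ∑[ i < t ] f i ≤ ∑[ i < t ] g i
∑-mono {zero}  f≤g = z≤n
∑-mono {suc t} f≤g = +-mono-≤ (f≤g zero) (∑-mono (λ i → f≤g (suc i)))

∑-mono-≡ : ∀ {t} {f g : Fin t → ℕ} → (∀ i → f i ≤ g i) → ∑[ i < t ] g i ≤ ∑[ i < t ] f i → ∀ i → f i ≡ g i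
∑-mono-≡ {suc t} {f} {g} f≤g ∑g≤∑f = pointwise
  where
  rest = ∑-mono {t} (λ i → f≤g (suc i))
  head : f zero ≡ g zero
  head = ≤-antisym (f≤g zero) (+-cancelʳ-≤ _ _ _ (≤-trans ∑g≤∑f (+-monoʳ-≤ (f zero) rest)))
  pointwise : ∀ i → f i ≡ g i
  pointwise zero    = head
  pointwise (suc i) = ∑-mono-≡ (λ i → f≤g (suc i))
    (+-cancelˡ-≤ (g zero) _ _ (subst (λ x → g zero + _ ≤ x + _) head ∑g≤∑f)) i

<ᵇ-true : ∀ {m n} → m < n → (m <ᵇ n) ≡ true
<ᵇ-true {zero}  (s≤s _)   = refl
<ᵇ-true {suc m} (s≤s m<n) = <ᵇ-true m<n

<ᵇ-false : ∀ {m n} → n ≤ m → (m <ᵇ n) ≡ false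
<ᵇ-false z≤n       = refl
<ᵇ-false (s≤s n≤m) = <ᵇ-false n≤m

<ᵇ-true⇒< : ∀ {m n} → (m <ᵇ n) ≡ true → m < n
<ᵇ-true⇒< {m} {n} m<ᵇn = <ᵇ⇒< m n (Equivalence.from T-≡ m<ᵇn)

-- Coalitions are handled through their characteristic functions lookup S; profileᵇ and classSizeᵇ
-- are the counting counterparts of profile and classSize.
profileᵇ : ∀ {n t} → (Fin n → Fin t) → (Fin n → Bool) → Fin t → ℕ
profileᵇ c s h = count (λ i → s i ∧ does (c i ≟ h))

classSizeᵇ : ∀ {n t} → (Fin n → Fin t) → Fin t → ℕ
classSizeᵇ c h = count (λ i → does (c i ≟ h))

∣∣≡count : ∀ {n} (S : Subset n) → ∣ S ∣ ≡ count (lookup S)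
∣∣≡count []          = refl
∣∣≡count (true ∷ S)  = cong suc (∣∣≡count S)
∣∣≡count (false ∷ S) = ∣∣≡count S

lookup-classSet : ∀ {n t} (c : Fin n → Fin t) h i → lookup (classSet c h) i ≡ does (c i ≟ h)
lookup-classSet c h i = trans (lookup∘tabulate _ i) (isYes≗does (c i ≟ h))

profile≡profileᵇ : ∀ {n t} (c : Fin n → Fin t) S h → profile c S h ≡ profileᵇ c (lookup S) h
profile≡profileᵇ c S h = trans (∣∣≡count (S ∩ classSet c h)) (count-cong (λ i →
  trans (lookup-zipWith _∧_ i S (classSet c h)) (cong (lookup S i ∧_) (lookup-classSet c h i))))

classSize≡classSizeᵇ : ∀ {n t} (c : Fin n → Fin t) h → classSize c h ≡ classSizeᵇ c h
classSize≡classSizeᵇ c h = trans (∣∣≡count (classSet c h)) (count-cong (lookup-classSet c h))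

countBelow : ∀ {n t} → (Fin n → Fin t) → ℕ → (Fin n → Bool) → ℕ
countBelow c k s = count (λ i → s i ∧ (toℕ (c i) <ᵇ k))

countBelow-step : ∀ {n t} (c : Fin n → Fin t) (h : Fin t) s →
  countBelow c (suc (toℕ h)) s ≡ countBelow c (toℕ h) s + profileᵇ c s h
countBelow-step c h s = trans (count-split (λ i → s i ∧ (toℕ (c i) <ᵇ suc (toℕ h))) (λ i → does (c i ≟ h)))
  (trans (+-comm (count (λ i → (s i ∧ (toℕ (c i) <ᵇ suc (toℕ h))) ∧ does (c i ≟ h))) _)
         (cong₂ _+_ (count-cong other) (count-cong this)))
  where
  <ᵇ-suc : ∀ {m k} → m ≢ k → (m <ᵇ suc k) ≡ (m <ᵇ k)
  <ᵇ-suc {zero}  {zero}  m≢k = ⊥-elim (m≢k refl)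
  <ᵇ-suc {zero}  {suc k} m≢k = refl
  <ᵇ-suc {suc m} {zero}  m≢k = refl
  <ᵇ-suc {suc m} {suc k} m≢k = <ᵇ-suc (λ m≡k → m≢k (cong suc m≡k))
  this : ∀ i → ((s i ∧ (toℕ (c i) <ᵇ suc (toℕ h))) ∧ does (c i ≟ h)) ≡ (s i ∧ does (c i ≟ h))
  this i with c i ≟ h
  ... | yes refl = trans (∧-identityʳ _) (cong (s i ∧_) (<ᵇ-true (n<1+n (toℕ h))))
  ... | no  _    = trans (∧-zeroʳ _) (sym (∧-zeroʳ (s i)))
  other : ∀ i → ((s i ∧ (toℕ (c i) <ᵇ suc (toℕ h))) ∧ not (does (c i ≟ h))) ≡ (s i ∧ (toℕ (c i) <ᵇ toℕ h))
  other i with c i ≟ h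
  ... | yes refl = trans (∧-zeroʳ _) (trans (sym (∧-zeroʳ (s i))) (cong (s i ∧_) (sym (<ᵇ-false {toℕ h} ≤-refl))))
  ... | no ci≢h  = trans (∧-identityʳ _) (cong (s i ∧_) (<ᵇ-suc (λ e → ci≢h (toℕ-injective e))))

countBelow-beyond : ∀ {n t} (c : Fin n → Fin t) {k} s → t ≤ k → countBelow c k s ≡ countBelow c t s
countBelow-beyond c s t≤k = count-cong (λ i →
  cong (s i ∧_) (trans (<ᵇ-true (≤-trans (toℕ<n (c i)) t≤k)) (sym (<ᵇ-true (toℕ<n (c i))))))

countBelow≡prefixSum : ∀ {n t} (c : Fin n → Fin t) k s → countBelow c k s ≡ prefixSum (profileᵇ c s) k
countBelow≡prefixSum {t = t} c zero s = trans (count-none (λ i → ∧-zeroʳ (s i))) (sym (prefixSum-zero (profileᵇ c s)))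
countBelow≡prefixSum {t = t} c (suc k) s with k <? t
... | yes k<t = begin
  countBelow c (suc k) s                          ≡⟨ cong (λ k → countBelow c (suc k) s) (sym k≡h) ⟩
  countBelow c (suc (toℕ h)) s                    ≡⟨ countBelow-step c h s ⟩
  countBelow c (toℕ h) s + profileᵇ c s h         ≡⟨ cong (_+ profileᵇ c s h) (cong (λ k → countBelow c k s) k≡h) ⟩
  countBelow c k s + profileᵇ c s h               ≡⟨ cong (_+ profileᵇ c s h) (countBelow≡prefixSum c k s) ⟩
  prefixSum (profileᵇ c s) k + profileᵇ c s h      ≡⟨ cong (_+ profileᵇ c s h) (cong (prefixSum (profileᵇ c s)) (sym k≡h)) ⟩
  prefixSum (profileᵇ c s) (toℕ h) + profileᵇ c s h ≡⟨ sym (prefixSum-step (profileᵇ c s) h) ⟩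
  prefixSum (profileᵇ c s) (suc (toℕ h))          ≡⟨ cong (λ k → prefixSum (profileᵇ c s) (suc k)) k≡h ⟩
  prefixSum (profileᵇ c s) (suc k)                ∎
  where
  open ≡-Reasoning
  h = fromℕ< k<t
  k≡h : toℕ h ≡ k
  k≡h = toℕ-fromℕ< k<t
... | no k≮t = begin
  countBelow c (suc k) s           ≡⟨ countBelow-beyond c s (m≤n⇒m≤1+n t≤k) ⟩
  countBelow c t s                 ≡⟨ sym (countBelow-beyond c s t≤k) ⟩
  countBelow c k s                 ≡⟨ countBelow≡prefixSum c k s ⟩
  prefixSum (profileᵇ c s) k       ≡⟨ prefixSum-beyond (profileᵇ c s) t≤k ⟩
  prefixSum (profileᵇ c s) t       ≡⟨ sym (prefixSum-beyond (profileᵇ c s) (m≤n⇒m≤1+n t≤k)) ⟩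
  prefixSum (profileᵇ c s) (suc k) ∎
  where
  open ≡-Reasoning
  t≤k = ≮⇒≥ k≮t

Realizes : ∀ {n t} → (Fin n → Fin t) → (Fin n → Bool) → (Fin t → ℕ) → Set
Realizes c A v = ∃[ s ] s ⊆ᵇ A × (∀ h → profileᵇ c s h ≡ v h)

realize-skip : ∀ {n t} {c : Fin (suc n) → Fin t} {A v} →
  Realizes (λ i → c (suc i)) (λ i → A (suc i)) v → Realizes c A v
realize-skip (s , s⊆A , prof) = (false ∷ᶠ s) , (λ { zero () ; (suc i) → s⊆A i }) , prof

realize-take : ∀ {n t} {c : Fin (suc n) → Fin t} {A v r} → A zero ≡ true → v (c zero) ≡ suc r →
  Realizes (λ i → c (suc i)) (λ i → A (suc i)) (λ h → if does (c zero ≟ h) then r else v h) → Realizes c A v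
realize-take {c = c} {v = v} {r} A₀ v₀ (s , s⊆A , prof) =
  (true ∷ᶠ s) , (λ { zero _ → A₀ ; (suc i) → s⊆A i }) , λ h → trans (cong (bit (does (c zero ≟ h)) +_) (prof h)) (head h (c zero ≟ h))
  where
  head : ∀ h (d : Dec (c zero ≡ h)) → bit (does d) + (if does d then r else v h) ≡ v h
  head h (yes refl) = sym v₀
  head h (no _)     = refl

realize : ∀ {n t} (c : Fin n → Fin t) (A : Fin n → Bool) (v : Fin t → ℕ) →
  (∀ h → v h ≤ profileᵇ c A h) → Realizes c A v
realize {zero}  c A v v≤A = (λ ()) , (λ ()) , (λ h → sym (n≤0⇒n≡0 (v≤A h)))
realize {suc n} c A v v≤A with A zero in A₀ | v (c zero) in v₀
... | false | _ = realize-skip {c = c} {A} (realize (λ i → c (suc i)) (λ i → A (suc i)) v v≤A)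
... | true | zero = realize-skip {c = c} {A} (realize (λ i → c (suc i)) (λ i → A (suc i)) v (λ h → bound h (c zero ≟ h) (v≤A h)))
  where
  bound : ∀ h (d : Dec (c zero ≡ h)) → v h ≤ bit (does d) + profileᵇ (λ i → c (suc i)) (λ i → A (suc i)) h →
          v h ≤ profileᵇ (λ i → c (suc i)) (λ i → A (suc i)) h
  bound h (yes refl) _  = subst (_≤ _) (sym v₀) z≤n
  bound h (no _)     v≤ = v≤
... | true | suc r = realize-take {c = c} {A} A₀ v₀ (realize (λ i → c (suc i)) (λ i → A (suc i)) _ (λ h → bound h (c zero ≟ h) (v≤A h)))
  where
  bound : ∀ h (d : Dec (c zero ≡ h)) → v h ≤ bit (does d) + profileᵇ (λ i → c (suc i)) (λ i → A (suc i)) h →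
          (if does d then r else v h) ≤ profileᵇ (λ i → c (suc i)) (λ i → A (suc i)) h
  bound h (yes refl) v≤ = ≤-pred (subst (_≤ _) v₀ v≤)
  bound h (no _)     v≤ = v≤

realize-valid : ∀ {n t} (c : Fin n → Fin t) (v : Fin t → ℕ) → ValidVec c v →
  Σ (Subset n) λ S → ∀ h → profile c S h ≡ v h
realize-valid c v valid = tabulate s , λ h →
  trans (profile≡profileᵇ c (tabulate s) h) (trans (count-cong (λ i → cong (_∧ _) (lookup∘tabulate s i))) (prof h))
  where
  realization = realize c (λ _ → true) v (λ h → subst (v h ≤_) (classSize≡classSizeᵇ c h) (valid h))
  s = proj₁ realization
  prof = proj₂ (proj₂ realization)

-- The game of a vector

true≢false : true ≢ false
true≢false ()

does-not-false⇒ : ∀ {A : Set} (d : Dec A) → not (does d) ≡ false → A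
does-not-false⇒ (yes a) _ = a

does-not-true⇒ : ∀ {A : Set} (d : Dec A) → not (does d) ≡ true → ¬ A
does-not-true⇒ (no ¬a) _ = ¬a

lookup-⁅⁆ : ∀ {n} (j i : Fin n) → lookup ⁅ j ⁆ i ≡ does (i ≟ j)
lookup-⁅⁆ zero    zero    = refl
lookup-⁅⁆ zero    (suc i) = lookup-replicate i false
lookup-⁅⁆ (suc j) zero    = refl
lookup-⁅⁆ (suc j) (suc i) = lookup-⁅⁆ j i

∉⇒lookup-false : ∀ {n} {i : Fin n} {S : Subset n} → i ∉ S → lookup S i ≡ false
∉⇒lookup-false {i = i} {S} i∉S with lookup S i in Sᵢ
... | true  = ⊥-elim (i∉S (lookup⇒[]= i S Sᵢ))
... | false = refl

add : ∀ {n} → Fin n → (Fin n → Bool) → Fin n → Bool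
add j s i = s i ∨ does (i ≟ j)

lookup-∪⁅⁆ : ∀ {n} (S : Subset n) j i → lookup (S ∪ ⁅ j ⁆) i ≡ add j (lookup S) i
lookup-∪⁅⁆ S j i = trans (lookup-zipWith _∨_ i S ⁅ j ⁆) (cong (lookup S i ∨_) (lookup-⁅⁆ j i))

countBelow-add : ∀ {n t} (c : Fin n → Fin t) k (s : Fin n → Bool) j → s j ≡ false →
  countBelow c k (add j s) ≡ countBelow c k s + bit (toℕ (c j) <ᵇ k)
countBelow-add c k s j sⱼ = begin
  countBelow c k (add j s)                                   ≡⟨ count-remove (λ i → add j s i ∧ below i) j ⟩
  count (λ i → (add j s i ∧ below i) ∧ not (does (i ≟ j))) + bit ((s j ∨ does (j ≟ j)) ∧ below j)
                                                             ≡⟨ cong₂ _+_ (count-cong rest) (cong bit added) ⟩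
  count (λ i → (s i ∧ below i) ∧ not (does (i ≟ j))) + bit (below j)
                                                             ≡⟨ cong (_+ bit (below j)) (sym old) ⟩
  countBelow c k s + bit (below j)                           ∎
  where
  open ≡-Reasoning
  below : _ → Bool
  below i = toℕ (c i) <ᵇ k
  added : ((s j ∨ does (j ≟ j)) ∧ below j) ≡ below j
  added rewrite dec-true (j ≟ j) refl | ∨-zeroʳ (s j) = refl
  rest : ∀ i → ((add j s i ∧ below i) ∧ not (does (i ≟ j))) ≡ ((s i ∧ below i) ∧ not (does (i ≟ j)))
  rest i with i ≟ j
  ... | yes _ = trans (∧-zeroʳ _) (sym (∧-zeroʳ _))
  ... | no  _ = cong (λ b → (b ∧ below i) ∧ true) (∨-identityʳ (s i))
  old : countBelow c k s ≡ count (λ i → (s i ∧ below i) ∧ not (does (i ≟ j)))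
  old = trans (count-remove (λ i → s i ∧ below i) j)
              (trans (cong (λ b → count (λ i → (s i ∧ below i) ∧ not (does (i ≟ j))) + bit (b ∧ below j)) sⱼ) (+-identityʳ _))

⪰⇒countBelow : ∀ {n t} (c : Fin n → Fin t) m s → m ⪰ profileᵇ c s → ∀ k → countBelow c k s ≤ prefixSum m k
⪰⇒countBelow c m s m⪰ k = subst (_≤ prefixSum m k) (sym (countBelow≡prefixSum c k s)) (m⪰ k)

countBelow⇒⪰ : ∀ {n t} (c : Fin n → Fin t) m s → (∀ k → countBelow c k s ≤ prefixSum m k) → m ⪰ profileᵇ c s
countBelow⇒⪰ c m s below k = subst (_≤ prefixSum m k) (countBelow≡prefixSum c k s) (below k)

⪰-≤ : ∀ {t} {m : Fin t → ℕ} {a b} → m ⪰ b → (∀ h → a h ≤ b h) → m ⪰ a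
⪰-≤ m⪰b a≤b k = ≤-trans (prefixSum-mono a≤b k) (m⪰b k)

profileᵇ-mono : ∀ {n t} (c : Fin n → Fin t) {s s′} → s ⊆ᵇ s′ → ∀ h → profileᵇ c s h ≤ profileᵇ c s′ h
profileᵇ-mono c s⊆s′ h = count-mono (∧-monoˡ-⊆ᵇ _ s⊆s′)

dominationWin : ∀ {n t} → (Fin n → Fin t) → (Fin t → ℕ) → Subset n → Bool
dominationWin c m S = not (does (m ⪰? profileᵇ c (lookup S)))

module _ {n t} (c : Fin n → Fin t) (m : Fin t → ℕ) where

  dominationWin-false : ∀ S → m ⪰ profileᵇ c (lookup S) → dominationWin c m S ≡ false
  dominationWin-false S m⪰ = cong not (dec-true (m ⪰? _) m⪰)

  dominationWin-true : ∀ S → ¬ m ⪰ profileᵇ c (lookup S) → dominationWin c m S ≡ true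
  dominationWin-true S m⋡ = cong not (dec-false (m ⪰? _) m⋡)

  dominationWin-false⇒ : ∀ S → dominationWin c m S ≡ false → m ⪰ profileᵇ c (lookup S)
  dominationWin-false⇒ S = does-not-false⇒ (m ⪰? _)

  dominationWin-true⇒ : ∀ S → dominationWin c m S ≡ true → ¬ m ⪰ profileᵇ c (lookup S)
  dominationWin-true⇒ S = does-not-true⇒ (m ⪰? _)

profileᵇ-⊤ : ∀ {n t} (c : Fin n → Fin t) h → profileᵇ c (lookup (Subset.⊤ {n})) h ≡ classSizeᵇ c h
profileᵇ-⊤ c h = count-cong (λ i → cong (_∧ does (c i ≟ h)) (lookup-replicate i true))

dominationGame : ∀ {n t} (c : Fin n → Fin (suc t)) (m : Fin (suc t) → ℕ) → m zero < classSizeᵇ c zero → SimpleGame n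
dominationGame {n} {t} c m m₀<σ₀ = record
  { W         = dominationWin c m
  ; empty-los = dominationWin-false c m Subset.⊥ (λ k → subst (_≤ prefixSum m k) (sym (empty k)) z≤n)
  ; grand-win = dominationWin-true c m Subset.⊤ (λ m⪰ → <⇒≱ m₀<σ₀ (head (m⪰ 1)))
  ; upward    = λ S T S⊆T → dominationWin-upward S T (λ i Sᵢ → []=⇒lookup (S⊆T (lookup⇒[]= i S Sᵢ)))
  }
  where
  empty : ∀ k → prefixSum (profileᵇ c (lookup (Subset.⊥ {n}))) k ≡ 0
  empty k = trans (sym (countBelow≡prefixSum c k (lookup Subset.⊥)))
                  (count-none (λ i → cong (_∧ (toℕ (c i) <ᵇ k)) (lookup-replicate i false)))
  prefixSum-1 : ∀ (a : Fin (suc t) → ℕ) → prefixSum a 1 ≡ a zero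
  prefixSum-1 a = trans (cong (a zero +_) (prefixSum-zero (λ h → a (suc h)))) (+-identityʳ (a zero))
  head : prefixSum (profileᵇ c (lookup Subset.⊤)) 1 ≤ prefixSum m 1 → classSizeᵇ c zero ≤ m zero
  head = subst₂ _≤_ (trans (prefixSum-1 (profileᵇ c (lookup Subset.⊤))) (profileᵇ-⊤ c zero)) (prefixSum-1 m)
  dominationWin-upward : ∀ S T → lookup S ⊆ᵇ lookup T → dominationWin c m S ≡ true → dominationWin c m T ≡ true
  dominationWin-upward S T S⊆T S-wins with dominationWin c m T in T-wins
  ... | true  = refl
  ... | false = ⊥-elim (dominationWin-true⇒ c m S S-wins
                  (⪰-≤ {m = m} {a = profileᵇ c (lookup S)} {b = profileᵇ c (lookup T)} (dominationWin-false⇒ c m T T-wins) (profileᵇ-mono c S⊆T)))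

does-true⇒ : ∀ {A : Set} (d : Dec A) → does d ≡ true → A
does-true⇒ (yes a) _ = a

countBelow-∪⁅⁆ : ∀ {n t} (c : Fin n → Fin t) k {S : Subset n} {j} → j ∉ S →
  countBelow c k (lookup (S ∪ ⁅ j ⁆)) ≡ countBelow c k (lookup S) + bit (toℕ (c j) <ᵇ k)
countBelow-∪⁅⁆ c k {S} {j} j∉S =
  trans (count-cong (λ i → cong (_∧ (toℕ (c i) <ᵇ k)) (lookup-∪⁅⁆ S j i))) (countBelow-add c k (lookup S) j (∉⇒lookup-false j∉S))

bit-<ᵇ-antitone : ∀ {a b} k → a ≤ b → bit (b <ᵇ k) ≤ bit (a <ᵇ k)
bit-<ᵇ-antitone {a} {b} k a≤b with b <ᵇ k in b<k
... | false = z≤n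
... | true  = ≤-reflexive (cong bit (sym (<ᵇ-true {a} {k} (≤-<-trans a≤b (<ᵇ-true⇒< b<k)))))

⪰-profile : ∀ {n t} (c : Fin n → Fin t) (m : Fin t → ℕ) {v} S → (∀ h → profile c S h ≡ v h) →
  m ⪰ profileᵇ c (lookup S) → m ⪰ v
⪰-profile c m S prof m⪰ k = subst (_≤ prefixSum m k) (prefixSum-cong (λ h → trans (sym (profile≡profileᵇ c S h)) (prof h)) k) (m⪰ k)

profile-⪰ : ∀ {n t} (c : Fin n → Fin t) (m : Fin t → ℕ) {v} S → (∀ h → profile c S h ≡ v h) →
  m ⪰ v → m ⪰ profileᵇ c (lookup S)
profile-⪰ c m S prof m⪰ k = subst (_≤ prefixSum m k) (prefixSum-cong (λ h → trans (sym (prof h)) (profile≡profileᵇ c S h)) k) (m⪰ k)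

-- The paper's conditions with classes 0-indexed: first-below is m₁ < n₁, below bounds mₕ < nₕ for
-- every class but the last, and positive gives mₕ ≥ 1 for every class but the first.
record Admissible {t} (σ m : Fin (suc t) → ℕ) : Set where
  field
    bounded     : ∀ h → m h ≤ σ h
    first-below : m zero < σ zero
    below       : ∀ h → toℕ h < t → m h < σ h
    positive    : ∀ h → 0 < m (suc h)

classSizeᵇ-without : ∀ {n t} (c : Fin n → Fin t) {i j : Fin n} → i ≢ j → ∀ h →
  classSizeᵇ c h ≡ profileᵇ c (λ k → not (does (k ≟ i)) ∧ not (does (k ≟ j))) h + bit (does (c j ≟ h)) + bit (does (c i ≟ h))
classSizeᵇ-without c {i} {j} i≢j h = begin
  count eq                                                                  ≡⟨ count-remove eq i ⟩
  count (λ k → eq k ∧ not (does (k ≟ i))) + bit (eq i)                       ≡⟨ cong (_+ bit (eq i)) (count-remove _ j) ⟩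
  count (λ k → (eq k ∧ not (does (k ≟ i))) ∧ not (does (k ≟ j))) + bit (eq j ∧ not (does (j ≟ i))) + bit (eq i)
    ≡⟨ cong (λ x → x + bit (eq i)) (cong₂ _+_ (count-cong reorder) (cong bit j≠i)) ⟩
  profileᵇ c (λ k → not (does (k ≟ i)) ∧ not (does (k ≟ j))) h + bit (eq j) + bit (eq i) ∎
  where
  open ≡-Reasoning
  eq : _ → Bool
  eq k = does (c k ≟ h)
  reorder : ∀ k → ((eq k ∧ not (does (k ≟ i))) ∧ not (does (k ≟ j))) ≡ ((not (does (k ≟ i)) ∧ not (does (k ≟ j))) ∧ eq k)
  reorder k = trans (∧-assoc (eq k) _ _) (∧-comm (eq k) _)
  j≠i : (eq j ∧ not (does (j ≟ i))) ≡ eq j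
  j≠i rewrite dec-false (j ≟ i) (λ j≡i → i≢j (sym j≡i)) = ∧-identityʳ (eq j)

module DominationGame {n t} (c : Fin n → Fin (suc t)) (m : Fin (suc t) → ℕ) (adm : Admissible (classSizeᵇ c) m) where
  open Admissible adm

  game : SimpleGame n
  game = dominationGame c m first-below

  desirable-if : ∀ i j → toℕ (c i) ≤ toℕ (c j) → Desirable game i j
  desirable-if i j ci≤cj S i∉S j∉S S∪j-wins with dominationWin c m (S ∪ ⁅ i ⁆) in S∪i-wins
  ... | true  = refl
  ... | false = ⊥-elim (dominationWin-true⇒ c m (S ∪ ⁅ j ⁆) S∪j-wins (countBelow⇒⪰ c m (lookup (S ∪ ⁅ j ⁆)) λ k → begin
      countBelow c k (lookup (S ∪ ⁅ j ⁆))              ≡⟨ countBelow-∪⁅⁆ c k j∉S ⟩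
      countBelow c k (lookup S) + bit (toℕ (c j) <ᵇ k) ≤⟨ +-monoʳ-≤ (countBelow c k (lookup S)) (bit-<ᵇ-antitone k ci≤cj) ⟩
      countBelow c k (lookup S) + bit (toℕ (c i) <ᵇ k) ≡⟨ sym (countBelow-∪⁅⁆ c k i∉S) ⟩
      countBelow c k (lookup (S ∪ ⁅ i ⁆))              ≤⟨ ⪰⇒countBelow c m _ (dominationWin-false⇒ c m (S ∪ ⁅ i ⁆) S∪i-wins) k ⟩
      prefixSum m k                                    ∎))
    where open ≤-Reasoning

  nonfirst-positive : ∀ h → 0 < toℕ h → 0 < m h
  nonfirst-positive (suc h) _ = positive h

  -- For j in a better class than i, a coalition S ∌ i, j with S ∪ {j} winning and S ∪ {i} losing:
  -- S realizes m with one member of the class of i removed.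
  module Separating (i j : Fin n) (cj<ci : toℕ (c j) < toℕ (c i)) where
    i≢j : i ≢ j
    i≢j refl = <-irrefl refl cj<ci

    δ v : Fin (suc t) → ℕ
    δ h = bit (does (c i ≟ h))
    v h = m h ∸ δ h

    m≡v+δ : ∀ h → m h ≡ v h + δ h
    m≡v+δ h with c i ≟ h
    ... | yes refl = sym (m∸n+n≡m (nonfirst-positive (c i) (≤-<-trans z≤n cj<ci)))
    ... | no  _    = sym (+-identityʳ (m h))

    m+j≤σ : ∀ h → m h + bit (does (c j ≟ h)) ≤ classSizeᵇ c h
    m+j≤σ h with c j ≟ h
    ... | yes refl = subst (_≤ classSizeᵇ c (c j)) (+-comm 1 _) (below (c j) (<-≤-trans cj<ci (≤-pred (toℕ<n (c i)))))
    ... | no  _    = subst (_≤ classSizeᵇ c h) (sym (+-identityʳ _)) (bounded h)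

    others : Fin n → Bool
    others k = not (does (k ≟ i)) ∧ not (does (k ≟ j))

    v≤ : ∀ h → v h ≤ profileᵇ c others h
    v≤ h = +-cancelʳ-≤ (bit (does (c j ≟ h)) + δ h) (v h) _ (begin
      v h + (bit (does (c j ≟ h)) + δ h)                   ≡⟨ shuffle (v h) _ (δ h) ⟩
      v h + δ h + bit (does (c j ≟ h))                     ≡⟨ cong (_+ bit (does (c j ≟ h))) (sym (m≡v+δ h)) ⟩
      m h + bit (does (c j ≟ h))                           ≤⟨ m+j≤σ h ⟩
      classSizeᵇ c h                                       ≡⟨ classSizeᵇ-without c i≢j h ⟩
      profileᵇ c others h + bit (does (c j ≟ h)) + δ h     ≡⟨ +-assoc (profileᵇ c others h) _ (δ h) ⟩
      profileᵇ c others h + (bit (does (c j ≟ h)) + δ h)   ∎)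
      where
      open ≤-Reasoning
      shuffle : ∀ a b c → a + (b + c) ≡ a + c + b
      shuffle = solve-∀
    realization = realize c others v v≤
    s = proj₁ realization

    S : Subset n
    S = tabulate s

    outside : ∀ k → others k ≡ false → k ∉ S
    outside k othersₖ k∈S = true≢false (trans (sym (proj₁ (proj₂ realization) k
      (trans (sym (lookup∘tabulate s k)) ([]=⇒lookup k∈S)))) othersₖ)

    i∉S : i ∉ S
    i∉S = outside i (cong (λ b → not b ∧ not (does (i ≟ j))) (dec-true (i ≟ i) refl))

    j∉S : j ∉ S
    j∉S = outside j (trans (cong (λ b → not (does (j ≟ i)) ∧ not b) (dec-true (j ≟ j) refl)) (∧-zeroʳ _))

    countBelow-S : ∀ k → countBelow c k (lookup S) ≡ prefixSum v k
    countBelow-S k = trans (count-cong (λ k′ → cong (_∧ (toℕ (c k′) <ᵇ k)) (lookup∘tabulate s k′)))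
                           (trans (countBelow≡prefixSum c k s) (prefixSum-cong (proj₂ (proj₂ realization)) k))

    prefixSum-m : ∀ k → prefixSum m k ≡ prefixSum v k + bit (toℕ (c i) <ᵇ k)
    prefixSum-m k = trans (prefixSum-cong m≡v+δ k) (trans (prefixSum-+ v δ k) (cong (prefixSum v k +_) (prefixSum-at (c i) k)))

    S∪i-loses : dominationWin c m (S ∪ ⁅ i ⁆) ≡ false
    S∪i-loses = dominationWin-false c m (S ∪ ⁅ i ⁆) (countBelow⇒⪰ c m _ (λ k → ≤-reflexive
      (trans (countBelow-∪⁅⁆ c k i∉S) (trans (cong (_+ _) (countBelow-S k)) (sym (prefixSum-m k))))))

    S∪j-wins : dominationWin c m (S ∪ ⁅ j ⁆) ≡ true
    S∪j-wins = dominationWin-true c m (S ∪ ⁅ j ⁆) (λ m⪰ → 1+n≰n (begin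
      suc (prefixSum v a)                                  ≡⟨ +-comm 1 (prefixSum v a) ⟩
      prefixSum v a + 1                                    ≡⟨ cong (λ b → prefixSum v a + bit b) (sym (<ᵇ-true (n<1+n (toℕ (c j))))) ⟩
      prefixSum v a + bit (toℕ (c j) <ᵇ a)                 ≡⟨ cong (_+ bit (toℕ (c j) <ᵇ a)) (sym (countBelow-S a)) ⟩
      countBelow c a (lookup S) + bit (toℕ (c j) <ᵇ a)     ≡⟨ sym (countBelow-∪⁅⁆ c a j∉S) ⟩
      countBelow c a (lookup (S ∪ ⁅ j ⁆))                  ≤⟨ ⪰⇒countBelow c m _ m⪰ a ⟩
      prefixSum m a                                        ≡⟨ prefixSum-m a ⟩
      prefixSum v a + bit (toℕ (c i) <ᵇ a)                 ≡⟨ cong (λ b → prefixSum v a + bit b) (<ᵇ-false cj<ci) ⟩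
      prefixSum v a + 0                                    ≡⟨ +-identityʳ _ ⟩
      prefixSum v a                                        ∎))
      where
      open ≤-Reasoning
      a = suc (toℕ (c j))

  desirable-only-if : ∀ i j → Desirable game i j → toℕ (c i) ≤ toℕ (c j)
  desirable-only-if i j i≿j with toℕ (c i) ≤? toℕ (c j)
  ... | yes ci≤cj = ci≤cj
  ... | no  ci≰cj = ⊥-elim (true≢false (trans (sym (i≿j S i∉S j∉S S∪j-wins)) S∪i-loses))
    where open Separating i j (≰⇒> ci≰cj)

  classes-nonempty : ∀ h → ∃[ i ] c i ≡ h
  classes-nonempty h = let i , cᵢ≡h = count-pos (λ i → does (c i ≟ h)) (nonempty h) in i , does-true⇒ (c i ≟ h) cᵢ≡h
    where
    nonempty : ∀ h → 0 < classSizeᵇ c h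
    nonempty zero    = ≤-<-trans z≤n first-below
    nonempty (suc h) = ≤-trans (positive h) (bounded (suc h))

  isClassMap : IsClassMap game (suc t) c
  isClassMap = classes-nonempty , λ i j → mk⇔ (desirable-only-if i j) (desirable-if i j)

  valid : ValidVec c m
  valid h = subst (m h ≤_) (sym (classSize≡classSizeᵇ c h)) (bounded h)

  losing : LosingVec game c m
  losing S prof = dominationWin-false c m S (profile-⪰ c m S prof (λ k → ≤-refl))

  shiftMaximal : ShiftMaxLosing game c m
  shiftMaximal = valid , losing , maximal
    where
    maximal : ∀ m′ → ValidVec c m′ → m′ ≻ m → WinningVec game c m′
    maximal m′ _ (m′⪰m , m′≢m) S prof with dominationWin c m S in S-wins
    ... | true  = refl
    ... | false = ⊥-elim (m′≢m (⪰-antisym m′⪰m (⪰-profile c m S prof (dominationWin-false⇒ c m S S-wins))))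

  unique : ∀ m″ → ShiftMaxLosing game c m″ → ∀ h → m″ h ≡ m h
  unique m″ (valid″ , losing″ , maximal″) with all? (λ h → m″ h ≟ℕ m h)
  ... | yes m″≡m = m″≡m
  ... | no  m″≢m = ⊥-elim (true≢false (trans (sym (maximal″ m valid (m⪰m″ , λ m≡m″ → m″≢m (λ h → sym (m≡m″ h))) S prof)) (losing S prof)))
    where
    S″ = proj₁ (realize-valid c m″ valid″)
    prof″ = proj₂ (realize-valid c m″ valid″)
    m⪰m″ : m ⪰ m″
    m⪰m″ = ⪰-profile c m S″ prof″ (dominationWin-false⇒ c m S″ (losing″ S″ prof″))
    S = proj₁ (realize-valid c m valid)
    prof = proj₂ (realize-valid c m valid)

  complete : CompleteOneSML (suc t) game
  complete = c , isClassMap , m , shiftMaximal , unique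

-- Complete games with a unique shift-maximal losing vector

argmax-where : ∀ {A : Set} {P : A → Set} (P? : Decidable P) (key : A → ℕ) (xs : List A) {x} → P x →
  Σ A λ y → P y × (∀ {z} → z ∈ xs → P z → key z ≤ key y)
argmax-where P? key xs {x} px = argmax key x (filter P? xs) , argmax-all key px (All.all-filter P? xs) ,
  λ z∈xs pz → All.lookup (f[xs]≤f[argmax] x (filter P? xs)) (∈-filter⁺ P? z∈xs pz)

_∖ᵇ_ : ∀ {n} → (Fin n → Bool) → (Fin n → Bool) → Fin n → Bool
(s ∖ᵇ τ) i = s i ∧ not (τ i)

bool-ext : ∀ {a b : Bool} → (a ≡ true → b ≡ true) → (b ≡ true → a ≡ true) → a ≡ b
bool-ext {true}  a⇒b _   = sym (a⇒b refl)
bool-ext {false} {true} _ b⇒a = b⇒a refl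
bool-ext {false} {false} _ _ = refl

countBelow-split : ∀ {n t} (c : Fin n → Fin t) k (s q : Fin n → Bool) →
  countBelow c k s ≡ countBelow c k (λ i → s i ∧ q i) + countBelow c k (s ∖ᵇ q)
countBelow-split c k s q = trans (count-split (λ i → s i ∧ (toℕ (c i) <ᵇ k)) q) (cong₂ _+_ (count-cong swap) (count-cong swap))
  where
  swap : ∀ {b : Fin _ → Bool} i → ((s i ∧ (toℕ (c i) <ᵇ k)) ∧ b i) ≡ ((s i ∧ b i) ∧ (toℕ (c i) <ᵇ k))
  swap {b} i = trans (∧-assoc (s i) _ (b i)) (trans (cong (s i ∧_) (∧-comm _ (b i))) (sym (∧-assoc (s i) (b i) _)))

countBelow-split′ : ∀ {n t} (c : Fin n → Fin t) k (s τ : Fin n → Bool) →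
  countBelow c k τ ≡ countBelow c k (λ i → s i ∧ τ i) + countBelow c k (τ ∖ᵇ s)
countBelow-split′ c k s τ =
  trans (countBelow-split c k τ s) (cong (_+ countBelow c k (τ ∖ᵇ s)) (count-cong (λ i → cong (_∧ _) (∧-comm (τ i) (s i)))))

module Shifting {n t} (G : SimpleGame n) (c : Fin n → Fin t)
                (desirable : ∀ i j → toℕ (c i) ≤ toℕ (c j) → Desirable G i j) where

  _≼_ : Subset n → Subset n → Set
  S ≼ T = ∀ k → countBelow c k (lookup S) ≤ countBelow c k (lookup T)

  ≼-differences : ∀ S T → S ≼ T → ∀ k → countBelow c k (lookup S ∖ᵇ lookup T) ≤ countBelow c k (lookup T ∖ᵇ lookup S)
  ≼-differences S T S≼T k = +-cancelˡ-≤ (countBelow c k (λ i → s i ∧ τ i)) _ _ (begin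
    countBelow c k (λ i → s i ∧ τ i) + countBelow c k (s ∖ᵇ τ) ≡⟨ sym (countBelow-split c k s τ) ⟩
    countBelow c k s                                          ≤⟨ S≼T k ⟩
    countBelow c k τ                                          ≡⟨ countBelow-split′ c k s τ ⟩
    countBelow c k (λ i → s i ∧ τ i) + countBelow c k (τ ∖ᵇ s) ∎)
    where
    open ≤-Reasoning
    s = lookup S
    τ = lookup T

  -- Replacing a member y ∈ S ∖ T by the member x ∈ T ∖ S of the worst class not worse than y's.
  module Shift (S T : Subset n) (y : Fin n) (y∈S : lookup S y ≡ true) (y∉T : lookup T y ≡ false)
               (S≼T : S ≼ T) (S-wins : W G S ≡ true) where

    s τ : Fin n → Bool
    s = lookup S
    τ = lookup T

    j : ℕ
    j = toℕ (c y)

    Candidate : Fin n → Set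
    Candidate z = (τ ∖ᵇ s) z ≡ true × toℕ (c z) ≤ j

    some-candidate : ∃ Candidate
    some-candidate = let z , e = count-pos _ (<-≤-trans y-counted (≼-differences S T S≼T (suc j))) in
      z , ∧-conicalˡ _ _ e , ≤-pred (<ᵇ-true⇒< (∧-conicalʳ ((τ ∖ᵇ s) z) _ e))
      where
      y-counted : 0 < countBelow c (suc j) (s ∖ᵇ τ)
      y-counted = count-pos⁺ _ y (subst₂ (λ a b → (a ∧ not b) ∧ (j <ᵇ suc j) ≡ true) (sym y∈S) (sym y∉T) (<ᵇ-true (n<1+n j)))

    best = argmax-where (λ z → ((τ ∖ᵇ s) z ≟ᵇ true) ×-dec (toℕ (c z) ≤? j)) (λ z → toℕ (c z)) (allFin n) (proj₂ some-candidate)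

    x : Fin n
    x = proj₁ best

    x≤y : toℕ (c x) ≤ j
    x≤y = proj₂ (proj₁ (proj₂ best))

    maximal : ∀ z → Candidate z → toℕ (c z) ≤ toℕ (c x)
    maximal z = proj₂ (proj₂ best) (∈-allFin z)

    x∈T : τ x ≡ true
    x∈T = ∧-conicalˡ _ _ (proj₁ (proj₁ (proj₂ best)))

    x∉S : s x ≡ false
    x∉S = not-injective (∧-conicalʳ (τ x) _ (proj₁ (proj₁ (proj₂ best))))

    B : Subset n
    B = tabulate (λ i → s i ∧ not (does (i ≟ y)))

    lookup-B : ∀ i → lookup B i ≡ (s i ∧ not (does (i ≟ y)))
    lookup-B = lookup∘tabulate _

    B∪y≡S : B ∪ ⁅ y ⁆ ≡ S
    B∪y≡S = trans (sym (tabulate∘lookup (B ∪ ⁅ y ⁆))) (trans (tabulate-cong same) (tabulate∘lookup S))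
      where
      same : ∀ i → lookup (B ∪ ⁅ y ⁆) i ≡ s i
      same i rewrite lookup-∪⁅⁆ B y i | lookup-B i with i ≟ y
      ... | yes refl = trans (∨-zeroʳ _) (sym y∈S)
      ... | no  _    = trans (∨-identityʳ _) (∧-identityʳ (s i))

    y∉B : y ∉ B
    y∉B y∈B = true≢false (trans (sym ([]=⇒lookup y∈B)) (trans (lookup-B y)
      (trans (cong (λ b → s y ∧ not b) (dec-true (y ≟ y) refl)) (∧-zeroʳ (s y)))))

    x∉B : x ∉ B
    x∉B x∈B = true≢false (trans (sym ([]=⇒lookup x∈B)) (trans (lookup-B x) (cong (_∧ not (does (x ≟ y))) x∉S)))

    S′ : Subset n
    S′ = B ∪ ⁅ x ⁆

    S′-wins : W G S′ ≡ true
    S′-wins = desirable x y x≤y B x∉B y∉B (subst (λ U → W G U ≡ true) (sym B∪y≡S) S-wins)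

    countBelow-S : ∀ k → countBelow c k s ≡ countBelow c k (lookup B) + bit (j <ᵇ k)
    countBelow-S k = trans (cong (λ U → countBelow c k (lookup U)) (sym B∪y≡S)) (countBelow-∪⁅⁆ c k y∉B)

    -- By maximality of x, no member of T ∖ S has its class strictly between x's and y's.
    gap : ∀ k → toℕ (c x) < k → k ≤ j → suc (countBelow c k (s ∖ᵇ τ)) ≤ countBelow c k (τ ∖ᵇ s)
    gap k x<k k≤j = begin
      suc (countBelow c k (s ∖ᵇ τ))   ≤⟨ count-strict y (below-mono (s ∖ᵇ τ) (m≤n⇒m≤1+n k≤j)) y-in y-out ⟩
      countBelow c (suc j) (s ∖ᵇ τ)   ≤⟨ ≼-differences S T S≼T (suc j) ⟩
      countBelow c (suc j) (τ ∖ᵇ s)   ≡⟨ count-cong same ⟩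
      countBelow c k (τ ∖ᵇ s)         ∎
      where
      open ≤-Reasoning
      below-mono : ∀ p {k k′} → k ≤ k′ → (λ i → p i ∧ (toℕ (c i) <ᵇ k)) ⊆ᵇ (λ i → p i ∧ (toℕ (c i) <ᵇ k′))
      below-mono p k≤k′ i e = let pᵢ = ∧-conicalˡ (p i) _ e ; lt = ∧-conicalʳ (p i) _ e in
        subst₂ (λ a b → a ∧ b ≡ true) (sym pᵢ) (sym (<ᵇ-true (<-≤-trans (<ᵇ-true⇒< lt) k≤k′))) refl
      y-in : ((s y ∧ not (τ y)) ∧ (j <ᵇ suc j)) ≡ true
      y-in = subst₂ (λ a b → (a ∧ not b) ∧ (j <ᵇ suc j) ≡ true) (sym y∈S) (sym y∉T) (<ᵇ-true (n<1+n j))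
      y-out : ((s y ∧ not (τ y)) ∧ (j <ᵇ k)) ≡ false
      y-out = trans (cong ((s y ∧ not (τ y)) ∧_) (<ᵇ-false k≤j)) (∧-zeroʳ _)
      same : ∀ i → ((τ ∖ᵇ s) i ∧ (toℕ (c i) <ᵇ suc j)) ≡ ((τ ∖ᵇ s) i ∧ (toℕ (c i) <ᵇ k))
      same i with (τ ∖ᵇ s) i in i∈T∖S
      ... | false = refl
      ... | true  = bool-ext (λ lt → <ᵇ-true (≤-<-trans (maximal i (i∈T∖S , ≤-pred (<ᵇ-true⇒< lt))) x<k))
                             (λ lt → <ᵇ-true (≤-trans (<ᵇ-true⇒< lt) (m≤n⇒m≤1+n k≤j)))

    S′≼T : S′ ≼ T
    S′≼T k with k ≤? toℕ (c x) | k ≤? j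
    ... | yes k≤x | _ = begin
      countBelow c k (lookup S′)                          ≡⟨ countBelow-∪⁅⁆ c k x∉B ⟩
      countBelow c k (lookup B) + bit (toℕ (c x) <ᵇ k)    ≡⟨ cong (λ b → countBelow c k (lookup B) + bit b) (<ᵇ-false k≤x) ⟩
      countBelow c k (lookup B) + 0                       ≤⟨ +-monoʳ-≤ (countBelow c k (lookup B)) z≤n ⟩
      countBelow c k (lookup B) + bit (j <ᵇ k)            ≡⟨ sym (countBelow-S k) ⟩
      countBelow c k s                                    ≤⟨ S≼T k ⟩
      countBelow c k τ                                    ∎
      where open ≤-Reasoning
    ... | no k≰x | no k≰j = begin
      countBelow c k (lookup S′)                          ≡⟨ countBelow-∪⁅⁆ c k x∉B ⟩
      countBelow c k (lookup B) + bit (toℕ (c x) <ᵇ k)    ≡⟨ cong (λ b → countBelow c k (lookup B) + bit b) both-below ⟩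
      countBelow c k (lookup B) + bit (j <ᵇ k)            ≡⟨ sym (countBelow-S k) ⟩
      countBelow c k s                                    ≤⟨ S≼T k ⟩
      countBelow c k τ                                    ∎
      where
      open ≤-Reasoning
      both-below : (toℕ (c x) <ᵇ k) ≡ (j <ᵇ k)
      both-below = trans (<ᵇ-true (≤-<-trans x≤y (≰⇒> k≰j))) (sym (<ᵇ-true (≰⇒> k≰j)))
    ... | no k≰x | yes k≤j = begin
      countBelow c k (lookup S′)                                      ≡⟨ countBelow-∪⁅⁆ c k x∉B ⟩
      countBelow c k (lookup B) + bit (toℕ (c x) <ᵇ k)                ≡⟨ cong (λ b → countBelow c k (lookup B) + bit b) (<ᵇ-true (≰⇒> k≰x)) ⟩
      countBelow c k (lookup B) + 1                                   ≡⟨ cong (_+ 1) (+-identityʳ _) ⟨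
      countBelow c k (lookup B) + 0 + 1                               ≡⟨ cong (λ b → countBelow c k (lookup B) + bit b + 1) (<ᵇ-false k≤j) ⟨
      countBelow c k (lookup B) + bit (j <ᵇ k) + 1                    ≡⟨ cong (_+ 1) (sym (countBelow-S k)) ⟩
      countBelow c k s + 1                                            ≡⟨ cong (_+ 1) (countBelow-split c k s τ) ⟩
      countBelow c k (λ i → s i ∧ τ i) + countBelow c k (s ∖ᵇ τ) + 1   ≡⟨ +-assoc (countBelow c k (λ i → s i ∧ τ i)) _ 1 ⟩
      countBelow c k (λ i → s i ∧ τ i) + (countBelow c k (s ∖ᵇ τ) + 1) ≤⟨ +-monoʳ-≤ (countBelow c k (λ i → s i ∧ τ i)) room ⟩
      countBelow c k (λ i → s i ∧ τ i) + countBelow c k (τ ∖ᵇ s)       ≡⟨ sym (countBelow-split′ c k s τ) ⟩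
      countBelow c k τ                                                ∎
      where
      open ≤-Reasoning
      room : countBelow c k (s ∖ᵇ τ) + 1 ≤ countBelow c k (τ ∖ᵇ s)
      room = subst (_≤ countBelow c k (τ ∖ᵇ s)) (+-comm 1 _) (gap k (≰⇒> k≰x) k≤j)

    measure : suc (count (lookup S′ ∖ᵇ τ)) ≡ count (s ∖ᵇ τ)
    measure = sym (begin
      count (s ∖ᵇ τ)                                                ≡⟨ count-remove (s ∖ᵇ τ) y ⟩
      count (λ i → (s ∖ᵇ τ) i ∧ not (does (i ≟ y))) + bit ((s ∖ᵇ τ) y)
        ≡⟨ cong₂ _+_ (count-cong same) (cong₂ (λ a b → bit (a ∧ not b)) y∈S y∉T) ⟩
      count (lookup S′ ∖ᵇ τ) + 1                                    ≡⟨ +-comm _ 1 ⟩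
      suc (count (lookup S′ ∖ᵇ τ))                                  ∎)
      where
      open ≡-Reasoning
      same : ∀ i → ((s ∖ᵇ τ) i ∧ not (does (i ≟ y))) ≡ (lookup S′ ∖ᵇ τ) i
      same i rewrite lookup-∪⁅⁆ B x i | lookup-B i with i ≟ x | i ≟ y
      ... | yes refl | _        rewrite x∉S | ∨-zeroʳ (false ∧ not (does (x ≟ y))) | x∈T = refl
      ... | no  _    | yes refl rewrite ∧-zeroʳ (s y ∧ not (τ y)) | ∧-zeroʳ (s y) = refl
      ... | no  _    | no  _    rewrite ∧-identityʳ (s i ∧ not (τ i)) | ∧-identityʳ (s i) = sym (cong (_∧ not (τ i)) (∨-identityʳ (s i)))

  monotone-by : ∀ fuel S T → count (lookup S ∖ᵇ lookup T) ≤ fuel → S ≼ T → W G S ≡ true → W G T ≡ true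
  monotone-by fuel S T bound S≼T S-wins with any? (λ y → (lookup S ∖ᵇ lookup T) y ≟ᵇ true)
  ... | no nothing-left = upward G S T S⊆T S-wins
    where
    S⊆T : S ⊆ T
    S⊆T {i} i∈S with lookup T i in Tᵢ
    ... | true  = lookup⇒[]= i T Tᵢ
    ... | false = ⊥-elim (nothing-left (i , subst₂ (λ a b → a ∧ not b ≡ true) (sym ([]=⇒lookup i∈S)) (sym Tᵢ) refl))
  ... | yes (y , y∈S∖T) with fuel
  ...   | zero      = ⊥-elim (<⇒≱ (count-pos⁺ _ y y∈S∖T) bound)
  ...   | suc fuel′ = monotone-by fuel′ S′ T (≤-pred (subst (_≤ suc fuel′) (sym measure) bound)) S′≼T S′-wins
    where
    open Shift S T y (∧-conicalˡ _ _ y∈S∖T) (not-injective (∧-conicalʳ (lookup S y) _ y∈S∖T)) S≼T S-wins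

  winning-monotone : ∀ S T → profileᵇ c (lookup T) ⪰ profileᵇ c (lookup S) → W G S ≡ true → W G T ≡ true
  winning-monotone S T T⪰S = monotone-by _ S T ≤-refl λ k →
    subst₂ _≤_ (sym (countBelow≡prefixSum c k (lookup S))) (sym (countBelow≡prefixSum c k (lookup T))) (T⪰S k)

allSubsets : ∀ n → List (Subset n)
allSubsets zero    = [] ∷ []
allSubsets (suc n) = map (true ∷_) (allSubsets n) ++ map (false ∷_) (allSubsets n)

∈-allSubsets : ∀ {n} (S : Subset n) → S ∈ allSubsets n
∈-allSubsets []          = here refl
∈-allSubsets (true ∷ S)  = ∈-++⁺ˡ (∈-map⁺ (true ∷_) (∈-allSubsets S))
∈-allSubsets {suc n} (false ∷ S) = ∈-++⁺ʳ (map (true ∷_) (allSubsets n)) (∈-map⁺ (false ∷_) (∈-allSubsets S))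

module CompleteGame {n t} (G : SimpleGame n) (c : Fin n → Fin (suc t)) (cm : IsClassMap G (suc t) c)
  (m : Fin (suc t) → ℕ) (sml : ShiftMaxLosing G c m) (unique : ∀ m′ → ShiftMaxLosing G c m′ → ∀ h → m′ h ≡ m h) where

  open Shifting G c (λ i j → Equivalence.from (proj₂ cm i j)) using (winning-monotone)

  valid : ValidVec c m
  valid = proj₁ sml

  losing : LosingVec G c m
  losing = proj₁ (proj₂ sml)

  weight : Subset n → ℕ
  weight T = ∑[ k < suc (suc t) ] prefixSum (profileᵇ c (lookup T)) (toℕ k)

  Candidate : Subset n → Subset n → Set
  Candidate S T = W G T ≡ false × profileᵇ c (lookup T) ⪰ profileᵇ c (lookup S)

  heaviest-shiftMaximal : ∀ S T → Candidate S T → (∀ T′ → Candidate S T′ → weight T′ ≤ weight T) →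
    ShiftMaxLosing G c (profile c T)
  heaviest-shiftMaximal S T (T-loses , T⪰S) heaviest = (λ h → ∣p∩q∣≤∣q∣ T (classSet c h)) , losingT , maximalT
    where
    p≡ : ∀ h → profile c T h ≡ profileᵇ c (lookup T) h
    p≡ = profile≡profileᵇ c T
    losingT : LosingVec G c (profile c T)
    losingT T″ prof″ with W G T″ in T″-wins
    ... | false = refl
    ... | true  = ⊥-elim (true≢false (trans (sym (winning-monotone T″ T T⪰T″ T″-wins)) T-loses))
      where
      T⪰T″ : profileᵇ c (lookup T) ⪰ profileᵇ c (lookup T″)
      T⪰T″ = profile-⪰ c (profileᵇ c (lookup T)) T″ prof″ (λ k → ≤-reflexive (prefixSum-cong p≡ k))
    maximalT : ∀ m′ → ValidVec c m′ → m′ ≻ profile c T → WinningVec G c m′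
    maximalT m′ _ (m′⪰p , m′≢p) T″ prof″ with W G T″ in T″-wins
    ... | true  = refl
    ... | false = ⊥-elim (m′≢p (⪰-antisym m′⪰p (⪰-profile c (profile c T) T″ prof″ p⪰T″)))
      where
      T″⪰T : profileᵇ c (lookup T″) ⪰ profileᵇ c (lookup T)
      T″⪰T k = subst₂ _≤_ (prefixSum-cong p≡ k) (prefixSum-cong (λ h → trans (sym (prof″ h)) (profile≡profileᵇ c T″ h)) k)
                 (m′⪰p k)
      T″-candidate : Candidate S T″
      T″-candidate = T″-wins , ⪰-trans (profileᵇ c (lookup T″)) (profileᵇ c (lookup T)) (profileᵇ c (lookup S)) T″⪰T T⪰S
      same : ∀ (k : Fin (suc (suc t))) → prefixSum (profileᵇ c (lookup T)) (toℕ k) ≡ prefixSum (profileᵇ c (lookup T″)) (toℕ k)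
      same = ∑-mono-≡ (λ k → T″⪰T (toℕ k)) (heaviest T″ T″-candidate)
      p⪰T″ : profile c T ⪰ profileᵇ c (lookup T″)
      p⪰T″ = ⪰-from-prefixes {a = profile c T} {b = profileᵇ c (lookup T″)}
               λ k → ≤-reflexive (trans (sym (same k)) (sym (prefixSum-cong p≡ (toℕ k))))

  -- The heaviest losing coalition dominating S has a shift-maximal, hence the unique, losing vector m.
  losing⇒dominated : ∀ S → W G S ≡ false → m ⪰ profileᵇ c (lookup S)
  losing⇒dominated S S-loses = ⪰-trans m (profileᵇ c (lookup T)) (profileᵇ c (lookup S)) m⪰T (proj₂ (proj₁ (proj₂ best)))
    where
    best = argmax-where (λ T → (W G T ≟ᵇ false) ×-dec (profileᵇ c (lookup T) ⪰? profileᵇ c (lookup S)))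
                        weight (allSubsets n) (S-loses , ⪰-refl (profileᵇ c (lookup S)))
    T = proj₁ best
    m≡p : ∀ h → profile c T h ≡ m h
    m≡p = unique (profile c T) (heaviest-shiftMaximal S T (proj₁ (proj₂ best)) (λ T′ → proj₂ (proj₂ best) (∈-allSubsets T′)))
    m⪰T : m ⪰ profileᵇ c (lookup T)
    m⪰T k = ≤-reflexive (trans (sym (prefixSum-cong (profile≡profileᵇ c T) k)) (prefixSum-cong m≡p k))

  W≡dominationWin : ∀ S → W G S ≡ dominationWin c m S
  W≡dominationWin S with W G S in S-wins | dominationWin c m S in S-dom
  ... | true  | true  = refl
  ... | false | false = refl
  ... | false | true  = ⊥-elim (dominationWin-true⇒ c m S S-dom (losing⇒dominated S S-wins))
  ... | true  | false = ⊥-elim (true≢false (trans (sym (winning-monotone S T T⪰S S-wins)) (losing T prof)))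
    where
    T = proj₁ (realize-valid c m valid)
    prof = proj₂ (realize-valid c m valid)
    T⪰S : profileᵇ c (lookup T) ⪰ profileᵇ c (lookup S)
    T⪰S k = subst (prefixSum (profileᵇ c (lookup S)) k ≤_) (prefixSum-cong (λ h → trans (sym (prof h)) (profile≡profileᵇ c T h)) k)
                  (dominationWin-false⇒ c m S S-dom k)

  desirable⇒≤ : ∀ i j → Desirable G i j → toℕ (c i) ≤ toℕ (c j)
  desirable⇒≤ i j = Equivalence.to (proj₂ cm i j)

  W-∪⁅⁆-false⇒ : ∀ S {i} → W G (S ∪ ⁅ i ⁆) ≡ false → ∀ k → countBelow c k (lookup (S ∪ ⁅ i ⁆)) ≤ prefixSum m k
  W-∪⁅⁆-false⇒ S {i} loses = ⪰⇒countBelow c m _ (dominationWin-false⇒ c m (S ∪ ⁅ i ⁆) (trans (sym (W≡dominationWin (S ∪ ⁅ i ⁆))) loses))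

  -- The classes a and b = a + 1 are distinct, so no room can be left for an extra member below b
  -- next to any S ∪ {i} that is dominated by m (otherwise i ∈ b would be as desirable as j ∈ a).
  no-room : ∀ (a b : Fin (suc t)) → toℕ b ≡ suc (toℕ a) →
    ¬ (∀ S {i j} → c i ≡ b → c j ≡ a → i ∉ S → j ∉ S → (∀ k → countBelow c k (lookup (S ∪ ⁅ i ⁆)) ≤ prefixSum m k) →
       suc (countBelow c (toℕ b) (lookup S)) ≤ prefixSum m (toℕ b))
  no-room a b b≡a+1 room = 1+n≰n (subst₂ _≤_ b≡a+1 refl (subst₂ (λ x y → toℕ x ≤ toℕ y) cᵢ≡b cⱼ≡a (desirable⇒≤ i j i≿j)))
    where
    i = proj₁ (proj₁ cm b)
    cᵢ≡b = proj₂ (proj₁ cm b)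
    j = proj₁ (proj₁ cm a)
    cⱼ≡a = proj₂ (proj₁ cm a)
    i≿j : Desirable G i j
    i≿j S i∉S j∉S S∪j-wins with W G (S ∪ ⁅ i ⁆) in S∪i-wins
    ... | true  = refl
    ... | false = ⊥-elim (true≢false (trans (sym S∪j-wins) (trans (W≡dominationWin (S ∪ ⁅ j ⁆))
        (dominationWin-false c m (S ∪ ⁅ j ⁆) (countBelow⇒⪰ c m _ S∪j-dominated)))))
      where
      dominated : ∀ k → countBelow c k (lookup (S ∪ ⁅ i ⁆)) ≤ prefixSum m k
      dominated = W-∪⁅⁆-false⇒ S S∪i-wins
      S∪j-dominated : ∀ k → countBelow c k (lookup (S ∪ ⁅ j ⁆)) ≤ prefixSum m k
      S∪j-dominated k with k ≟ℕ toℕ b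
      ... | yes refl = subst (_≤ prefixSum m (toℕ b)) (sym (trans (countBelow-∪⁅⁆ c (toℕ b) j∉S)
            (trans (cong (λ x → countBelow c (toℕ b) (lookup S) + bit (toℕ x <ᵇ toℕ b)) cⱼ≡a)
                   (trans (cong (λ x → countBelow c (toℕ b) (lookup S) + bit x) (<ᵇ-true (≤-reflexive (sym b≡a+1))))
                          (+-comm (countBelow c (toℕ b) (lookup S)) 1)))))
            (room S cᵢ≡b cⱼ≡a i∉S j∉S dominated)
      ... | no  k≢b  = subst (_≤ prefixSum m k) (trans (countBelow-∪⁅⁆ c k i∉S)
            (trans (cong (λ b → countBelow c k (lookup S) + bit b) (same k≢b)) (sym (countBelow-∪⁅⁆ c k j∉S)))) (dominated k)
        where
        same : k ≢ toℕ b → (toℕ (c i) <ᵇ k) ≡ (toℕ (c j) <ᵇ k)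
        same k≢b rewrite cᵢ≡b | cⱼ≡a | b≡a+1 with k ≤? toℕ a
        ... | yes k≤a = trans (<ᵇ-false (m≤n⇒m≤1+n k≤a)) (sym (<ᵇ-false k≤a))
        ... | no  k≰a = trans (<ᵇ-true (≤∧≢⇒< (≰⇒> k≰a) (λ e → k≢b (sym e)))) (sym (<ᵇ-true (≰⇒> k≰a)))

  bounded : ∀ h → m h ≤ classSizeᵇ c h
  bounded h = subst (m h ≤_) (classSize≡classSizeᵇ c h) (valid h)

  below : ∀ a → toℕ a < t → m a < classSizeᵇ c a
  below a a<t with m a <? classSizeᵇ c a
  ... | yes m<σ = m<σ
  ... | no  m≮σ = ⊥-elim (no-room a b (toℕ-fromℕ< (s≤s a<t)) room)
    where
    b = fromℕ< (s≤s a<t)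
    room : ∀ S {i j} → c i ≡ b → c j ≡ a → i ∉ S → j ∉ S → (∀ k → countBelow c k (lookup (S ∪ ⁅ i ⁆)) ≤ prefixSum m k) →
           suc (countBelow c (toℕ b) (lookup S)) ≤ prefixSum m (toℕ b)
    room S {i} {j} cᵢ≡b cⱼ≡a i∉S j∉S dominated = begin
      suc (countBelow c (toℕ b) s)                     ≡⟨ cong (λ k → suc (countBelow c k s)) (toℕ-fromℕ< (s≤s a<t)) ⟩
      suc (countBelow c (suc (toℕ a)) s)               ≡⟨ cong suc (countBelow-step c a s) ⟩
      suc (countBelow c (toℕ a) s + profileᵇ c s a)     ≡⟨ sym (+-suc _ _) ⟩
      countBelow c (toℕ a) s + suc (profileᵇ c s a)     ≤⟨ +-mono-≤ before (≤-trans missing-j (≮⇒≥ m≮σ)) ⟩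
      prefixSum m (toℕ a) + m a                        ≡⟨ sym (prefixSum-step m a) ⟩
      prefixSum m (suc (toℕ a))                        ≡⟨ cong (prefixSum m) (sym (toℕ-fromℕ< (s≤s a<t))) ⟩
      prefixSum m (toℕ b)                              ∎
      where
      open ≤-Reasoning
      s = lookup S
      before : countBelow c (toℕ a) s ≤ prefixSum m (toℕ a)
      before = subst (_≤ prefixSum m (toℕ a))
        (trans (countBelow-∪⁅⁆ c (toℕ a) i∉S) (trans (cong (λ x → countBelow c (toℕ a) s + bit (toℕ x <ᵇ toℕ a)) cᵢ≡b)
          (trans (cong (λ x → countBelow c (toℕ a) s + bit x) (<ᵇ-false (≤-trans (n≤1+n _) (≤-reflexive (sym (toℕ-fromℕ< (s≤s a<t)))))))
                 (+-identityʳ _))))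
        (dominated (toℕ a))
      missing-j : suc (profileᵇ c s a) ≤ classSizeᵇ c a
      missing-j = count-strict j (λ k e → ∧-conicalʳ (s k) _ e) (trans (cong (λ x → does (x ≟ a)) cⱼ≡a) (dec-true (a ≟ a) refl))
                    (trans (cong (_∧ does (c j ≟ a)) (∉⇒lookup-false j∉S)) refl)

  positive : ∀ h → 0 < m (suc h)
  positive h with m (suc h) in m-b
  ... | suc _ = s≤s z≤n
  ... | zero  = ⊥-elim (no-room a b (cong suc (sym (toℕ-inject₁ h))) room)
    where
    a = inject₁ h
    b = suc h
    room : ∀ S {i j} → c i ≡ b → c j ≡ a → i ∉ S → j ∉ S → (∀ k → countBelow c k (lookup (S ∪ ⁅ i ⁆)) ≤ prefixSum m k) →
           suc (countBelow c (toℕ b) (lookup S)) ≤ prefixSum m (toℕ b)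
    room S {i} cᵢ≡b _ i∉S _ dominated = begin
      suc (countBelow c (toℕ b) s)                          ≤⟨ s≤s (m≤m+n _ _) ⟩
      suc (countBelow c (toℕ b) s + profileᵇ c s b)          ≡⟨ cong suc (sym (countBelow-step c b s)) ⟩
      suc (countBelow c (suc (toℕ b)) s)                    ≡⟨ +-comm 1 _ ⟩
      countBelow c (suc (toℕ b)) s + 1                      ≡⟨ cong (λ x → countBelow c (suc (toℕ b)) s + bit x) i-below ⟨
      countBelow c (suc (toℕ b)) s + bit (toℕ (c i) <ᵇ suc (toℕ b)) ≡⟨ countBelow-∪⁅⁆ c (suc (toℕ b)) i∉S ⟨
      countBelow c (suc (toℕ b)) (lookup (S ∪ ⁅ i ⁆))        ≤⟨ dominated (suc (toℕ b)) ⟩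
      prefixSum m (suc (toℕ b))                             ≡⟨ prefixSum-step m b ⟩
      prefixSum m (toℕ b) + m b                             ≡⟨ cong (prefixSum m (toℕ b) +_) m-b ⟩
      prefixSum m (toℕ b) + 0                               ≡⟨ +-identityʳ _ ⟩
      prefixSum m (toℕ b)                                   ∎
      where
      open ≤-Reasoning
      s = lookup S
      i-below : (toℕ (c i) <ᵇ suc (toℕ b)) ≡ true
      i-below = <ᵇ-true (subst (_< suc (toℕ b)) (cong toℕ (sym cᵢ≡b)) (n<1+n _))

  first-below : m zero < classSizeᵇ c zero
  first-below with 0 <? t
  ... | yes 0<t = below zero 0<t
  ... | no  0≮t with m zero <? classSizeᵇ c zero
  ...   | yes m<σ = m<σ
  ...   | no  m≮σ = ⊥-elim (true≢false (trans (sym (grand-win G)) (trans (W≡dominationWin Subset.⊤)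
          (dominationWin-false c m Subset.⊤ (prefixSum-mono (λ h → subst (λ h → profileᵇ c (lookup Subset.⊤) h ≤ m h) (sym (only-zero h))
            (≤-trans (≤-reflexive (profileᵇ-⊤ c zero)) (≮⇒≥ m≮σ))))))))
    where
    only-zero : ∀ (h : Fin (suc t)) → h ≡ zero
    only-zero h = toℕ-injective (n≤0⇒n≡0 (≤-trans (≤-pred (toℕ<n h)) (≮⇒≥ 0≮t)))

  admissible : Admissible (classSizeᵇ c) m
  admissible = record { bounded = bounded ; first-below = first-below ; below = below ; positive = positive }

-- Isomorphisms

module _ {n} (π : Permutation′ n) where

  lookup-img : ∀ S j → lookup (img π S) j ≡ lookup S (π ⟨$⟩ˡ j)
  lookup-img S j = lookup∘tabulate _ j

  lookup-img-π : ∀ S i → lookup (img π S) (π ⟨$⟩ʳ i) ≡ lookup S i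
  lookup-img-π S i = trans (lookup-img S (π ⟨$⟩ʳ i)) (cong (lookup S) (inverseˡ π))

  img-flip : ∀ S → img π (img (flip π) S) ≡ S
  img-flip S = trans (sym (tabulate∘lookup (img π (img (flip π) S)))) (trans (tabulate-cong same) (tabulate∘lookup S))
    where
    same : ∀ j → lookup (img π (img (flip π) S)) j ≡ lookup S j
    same j = trans (lookup-img (img (flip π) S) j) (trans (lookup∘tabulate _ (π ⟨$⟩ˡ j)) (cong (lookup S) (inverseʳ π)))

  img-∪⁅⁆ : ∀ S j → img π (S ∪ ⁅ j ⁆) ≡ img π S ∪ ⁅ π ⟨$⟩ʳ j ⁆
  img-∪⁅⁆ S j = trans (sym (tabulate∘lookup (img π (S ∪ ⁅ j ⁆)))) (trans (tabulate-cong same) (tabulate∘lookup _))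
    where
    same : ∀ k → lookup (img π (S ∪ ⁅ j ⁆)) k ≡ lookup (img π S ∪ ⁅ π ⟨$⟩ʳ j ⁆) k
    same k rewrite lookup-img (S ∪ ⁅ j ⁆) k | lookup-∪⁅⁆ S j (π ⟨$⟩ˡ k) | lookup-∪⁅⁆ (img π S) (π ⟨$⟩ʳ j) k
                 | lookup-img S k with π ⟨$⟩ˡ k ≟ j | k ≟ π ⟨$⟩ʳ j
    ... | yes refl | yes _    = refl
    ... | yes refl | no  k≢πj = ⊥-elim (k≢πj (sym (inverseʳ π)))
    ... | no  πk≢j | yes refl = ⊥-elim (πk≢j (inverseˡ π))
    ... | no  _    | no  _    = refl

  ∉-img : ∀ {S i} → i ∉ S → π ⟨$⟩ʳ i ∉ img π S
  ∉-img {S} {i} i∉S πi∈ = i∉S (lookup⇒[]= i S (trans (sym (lookup-img-π S i)) ([]=⇒lookup πi∈)))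

  profileᵇ-img : ∀ {t} (c : Fin n → Fin t) S h → profileᵇ c (lookup (img π S)) h ≡ profileᵇ (λ i → c (π ⟨$⟩ʳ i)) (lookup S) h
  profileᵇ-img c S h = trans (sym (count-permute π _)) (count-cong (λ i → cong (_∧ does (c (π ⟨$⟩ʳ i) ≟ h)) (lookup-img-π S i)))

  classSizeᵇ-permute : ∀ {t} (c : Fin n → Fin t) h → classSizeᵇ (λ i → c (π ⟨$⟩ʳ i)) h ≡ classSizeᵇ c h
  classSizeᵇ-permute c h = count-permute π (λ i → does (c i ≟ h))

  profile-img : ∀ {t} (c : Fin n → Fin t) S h → profile c (img π S) h ≡ profile (λ i → c (π ⟨$⟩ʳ i)) S h
  profile-img c S h = trans (profile≡profileᵇ c (img π S) h) (trans (profileᵇ-img c S h) (sym (profile≡profileᵇ (λ i → c (π ⟨$⟩ʳ i)) S h)))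

  classSize-permute : ∀ {t} (c : Fin n → Fin t) h → classSize (λ i → c (π ⟨$⟩ʳ i)) h ≡ classSize c h
  classSize-permute c h = trans (classSize≡classSizeᵇ (λ i → c (π ⟨$⟩ʳ i)) h) (trans (classSizeᵇ-permute c h) (sym (classSize≡classSizeᵇ c h)))

Isomorphic-sym : ∀ {n} {G H : SimpleGame n} → Isomorphic G H → Isomorphic H G
Isomorphic-sym {G = G} {H} (π , preserves) = flip π , λ S → trans (sym (preserves (img (flip π) S))) (cong (W H) (img-flip π S))

desirable-reflect : ∀ {n} {G H : SimpleGame n} (iso : Isomorphic G H) i j →
  Desirable H (proj₁ iso ⟨$⟩ʳ i) (proj₁ iso ⟨$⟩ʳ j) → Desirable G i j
desirable-reflect {H = H} (π , preserves) i j πi≿πj S i∉S j∉S S∪j-wins = trans (sym (preserves (S ∪ ⁅ i ⁆)))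
  (trans (cong (W H) (img-∪⁅⁆ π S i)) (πi≿πj (img π S) (∉-img π i∉S) (∉-img π j∉S)
    (trans (cong (W H) (sym (img-∪⁅⁆ π S j))) (trans (preserves (S ∪ ⁅ j ⁆)) S∪j-wins))))

classMap-transport : ∀ {n t} {G H : SimpleGame n} (iso : Isomorphic G H) {c : Fin n → Fin t} →
  IsClassMap H t c → IsClassMap G t (λ i → c (proj₁ iso ⟨$⟩ʳ i))
classMap-transport {G = G} {H} iso@(π , _) {c} (onto , order) = onto′ , λ i j →
  mk⇔ (λ i≿j → Equivalence.to (order (π ⟨$⟩ʳ i) (π ⟨$⟩ʳ j)) (forward i j i≿j))
      (λ ci≤cj → desirable-reflect {G = G} {H} iso i j (Equivalence.from (order (π ⟨$⟩ʳ i) (π ⟨$⟩ʳ j)) ci≤cj))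
  where
  onto′ : ∀ h → ∃[ i ] c (π ⟨$⟩ʳ i) ≡ h
  onto′ h = π ⟨$⟩ˡ proj₁ (onto h) , trans (cong c (inverseʳ π)) (proj₂ (onto h))
  forward : ∀ i j → Desirable G i j → Desirable H (π ⟨$⟩ʳ i) (π ⟨$⟩ʳ j)
  forward i j i≿j = desirable-reflect {G = H} {G} (Isomorphic-sym {G = G} {H} iso) (π ⟨$⟩ʳ i) (π ⟨$⟩ʳ j)
    (subst₂ (Desirable G) (sym (inverseˡ π)) (sym (inverseˡ π)) i≿j)

shiftMaxLosing-transport : ∀ {n t} {G H : SimpleGame n} (iso : Isomorphic G H) {c : Fin n → Fin t} {v} →
  ShiftMaxLosing H c v → ShiftMaxLosing G (λ i → c (proj₁ iso ⟨$⟩ʳ i)) v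
shiftMaxLosing-transport {G = G} {H} (π , preserves) {c} (valid , losing , maximal) =
  (λ h → subst (_ ≤_) (sym (classSize-permute π c h)) (valid h)) ,
  (λ S prof → trans (sym (preserves S)) (losing (img π S) (λ h → trans (profile-img π c S h) (prof h)))) ,
  (λ m′ valid′ m′≻v S prof → trans (sym (preserves S))
     (maximal m′ (λ h → subst (_ ≤_) (classSize-permute π c h) (valid′ h)) m′≻v (img π S) (λ h → trans (profile-img π c S h) (prof h))))

classSet-cong : ∀ {n t} {c c′ : Fin n → Fin t} → (∀ i → c i ≡ c′ i) → ∀ h → classSet c h ≡ classSet c′ h
classSet-cong c≗c′ h = tabulate-cong (λ i → cong (λ x → ⌊ x ≟ h ⌋) (c≗c′ i))

shiftMaxLosing-cong : ∀ {n t} {G : SimpleGame n} {c c′ : Fin n → Fin t} {v} → (∀ i → c i ≡ c′ i) →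
  ShiftMaxLosing G c v → ShiftMaxLosing G c′ v
shiftMaxLosing-cong {c = c} {c′} c≗c′ (valid , losing , maximal) =
  (λ h → subst (_ ≤_) (size h) (valid h)) ,
  (λ S prof → losing S (λ h → trans (profile′ S h) (prof h))) ,
  (λ m′ valid′ m′≻v S prof → maximal m′ (λ h → subst (_ ≤_) (sym (size h)) (valid′ h)) m′≻v S (λ h → trans (profile′ S h) (prof h)))
  where
  size : ∀ h → classSize c h ≡ classSize c′ h
  size h = cong ∣_∣ (classSet-cong c≗c′ h)
  profile′ : ∀ S h → profile c S h ≡ profile c′ S h
  profile′ S h = cong (λ X → ∣ S ∩ X ∣) (classSet-cong c≗c′ h)

ranking-≤ : ∀ {n t t′} (c : Fin n → Fin t) (c′ : Fin n → Fin t′) → (∀ h → ∃[ i ] c i ≡ h) →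
  (∀ i j → toℕ (c′ i) ≤ toℕ (c′ j) → toℕ (c i) ≤ toℕ (c j)) → ∀ i → toℕ (c i) ≤ toℕ (c′ i)
ranking-≤ {t = t} c c′ onto reflects i = go (toℕ (c i)) i refl
  where
  go : ∀ r i → toℕ (c i) ≡ r → toℕ (c i) ≤ toℕ (c′ i)
  go zero    i cᵢ≡0 = subst (_≤ toℕ (c′ i)) (sym cᵢ≡0) z≤n
  go (suc r) i cᵢ≡1+r = begin
    toℕ (c i)      ≡⟨ cᵢ≡1+r ⟩
    suc r          ≡⟨ cong suc (sym cₖ≡r) ⟩
    suc (toℕ (c k)) ≤⟨ s≤s (go r k cₖ≡r) ⟩
    suc (toℕ (c′ k)) ≤⟨ c′ₖ<c′ᵢ ⟩
    toℕ (c′ i)     ∎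
    where
    open ≤-Reasoning
    r<t : r < t
    r<t = <-trans (subst (r <_) (sym cᵢ≡1+r) (n<1+n r)) (toℕ<n (c i))
    k = proj₁ (onto (fromℕ< r<t))
    cₖ≡r : toℕ (c k) ≡ r
    cₖ≡r = trans (cong toℕ (proj₂ (onto (fromℕ< r<t)))) (toℕ-fromℕ< r<t)
    c′ₖ<c′ᵢ : toℕ (c′ k) < toℕ (c′ i)
    c′ₖ<c′ᵢ with toℕ (c′ i) ≤? toℕ (c′ k)
    ... | yes c′ᵢ≤c′ₖ = ⊥-elim (1+n≰n (subst₂ _≤_ cᵢ≡1+r cₖ≡r (reflects i k c′ᵢ≤c′ₖ)))
    ... | no  c′ᵢ≰c′ₖ = ≰⇒> c′ᵢ≰c′ₖ

classes-≤ : ∀ {n t t′} (c : Fin n → Fin t) (c′ : Fin n → Fin t′) → (∀ h → ∃[ i ] c i ≡ h) →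
  (∀ i → toℕ (c i) ≤ toℕ (c′ i)) → t ≤ t′
classes-≤ {t = zero}  c c′ onto c≤c′ = z≤n
classes-≤ {t = suc r} c c′ onto c≤c′ = subst (λ x → suc x ≤ _) (trans (cong toℕ (proj₂ (onto (fromℕ r)))) (toℕ-fromℕ r))
  (<-≤-trans (s≤s (c≤c′ k)) (toℕ<n (c′ k)))
  where k = proj₁ (onto (fromℕ r))

classMap-unique : ∀ {n t t′} {G : SimpleGame n} {c : Fin n → Fin t} {c′ : Fin n → Fin t′} →
  IsClassMap G t c → IsClassMap G t′ c′ → t ≡ t′ × (∀ i → toℕ (c i) ≡ toℕ (c′ i))
classMap-unique {c = c} {c′} (onto , order) (onto′ , order′) =
  ≤-antisym (classes-≤ c c′ onto c≤c′) (classes-≤ c′ c onto′ c′≤c) , λ i → ≤-antisym (c≤c′ i) (c′≤c i)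
  where
  c≤c′ : ∀ i → toℕ (c i) ≤ toℕ (c′ i)
  c≤c′ = ranking-≤ c c′ onto (λ i j ≤′ → Equivalence.to (order i j) (Equivalence.from (order′ i j) ≤′))
  c′≤c : ∀ i → toℕ (c′ i) ≤ toℕ (c i)
  c′≤c = ranking-≤ c′ c onto′ (λ i j ≤ → Equivalence.to (order′ i j) (Equivalence.from (order i j) ≤))

iso⇒same-classes : ∀ {n t t′} {G H : SimpleGame n} → Isomorphic G H → CompleteOneSML t G → CompleteOneSML t′ H → t ≡ t′
iso⇒same-classes {G = G} {H} iso (_ , cm , _) (_ , cm′ , _) = proj₁ (classMap-unique {G = G} cm (classMap-transport {G = G} {H} iso cm′))

iso⇒same-type : ∀ {n t} {G H : SimpleGame n} → Isomorphic G H → (pg : CompleteOneSML t G) (ph : CompleteOneSML t H) →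
  (∀ h → classSizeᵇ (proj₁ pg) h ≡ classSizeᵇ (proj₁ ph) h) × (∀ h → proj₁ (proj₂ (proj₂ pg)) h ≡ proj₁ (proj₂ (proj₂ ph)) h)
iso⇒same-type {G = G} {H} iso@(π , _) (c , cm , m , _ , unique) (c′ , cm′ , m′ , sml′ , _) =
  (λ h → trans (count-cong (λ i → cong (λ x → does (x ≟ h)) (c≡c′π i))) (classSizeᵇ-permute π c′ h)) ,
  (λ h → sym (unique m′ (shiftMaxLosing-cong {G = G} (λ i → sym (c≡c′π i)) (shiftMaxLosing-transport {G = G} {H} iso sml′)) h))
  where
  c≡c′π : ∀ i → c i ≡ c′ (π ⟨$⟩ʳ i)
  c≡c′π i = toℕ-injective (proj₂ (classMap-unique {G = G} cm (classMap-transport {G = G} {H} iso cm′)) i)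

does-≟-sym : ∀ {n} (i j : Fin n) → does (i ≟ j) ≡ does (j ≟ i)
does-≟-sym i j with i ≟ j
... | yes refl = sym (dec-true (i ≟ i) refl)
... | no  i≢j  = sym (dec-false (j ≟ i) (λ j≡i → i≢j (sym j≡i)))

count-≟ : ∀ {n} (j : Fin n) → count (λ i → does (j ≟ i)) ≡ 1
count-≟ j = trans (count-cong (λ i → does-≟-sym j i)) (count-at (λ _ → true) j)

∑-classSizeᵇ : ∀ {n t} (c : Fin n → Fin t) → ∑[ h < t ] classSizeᵇ c h ≡ n
∑-classSizeᵇ {zero}  {t} c = trans (sum-cong-≗ {t} (λ h → refl)) (count-none {t} {λ _ → false} (λ _ → refl))
∑-classSizeᵇ {suc n} {t} c = begin
  ∑[ h < t ] (bit (does (c zero ≟ h)) + classSizeᵇ (λ i → c (suc i)) h)        ≡⟨ ∑-distrib-+ (λ h → bit (does (c zero ≟ h))) _ ⟩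
  count (λ h → does (c zero ≟ h)) + ∑[ h < t ] classSizeᵇ (λ i → c (suc i)) h
    ≡⟨ cong₂ _+_ (count-≟ (c zero)) (∑-classSizeᵇ (λ i → c (suc i))) ⟩
  suc n                                                                         ∎
  where open ≡-Reasoning

∑-pos : ∀ {t} (σ : Fin t → ℕ) → 0 < ∑[ h < t ] σ h → ∃[ h ] 0 < σ h
∑-pos {suc t} σ pos with σ zero in σ₀
... | suc _ = zero , subst (0 <_) (sym σ₀) (s≤s z≤n)
... | zero  = let h , σₕ = ∑-pos (λ h → σ (suc h)) pos in suc h , σₕ

classMap-with-sizes : ∀ n {t} (σ : Fin t → ℕ) → ∑[ h < t ] σ h ≡ n → Σ (Fin n → Fin t) λ c → ∀ h → classSizeᵇ c h ≡ σ h
classMap-with-sizes zero    σ ∑σ≡0 = (λ ()) , λ h → sym (n≤0⇒n≡0 (subst (σ h ≤_) ∑σ≡0 (σ≤∑σ σ h)))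
  where
  σ≤∑σ : ∀ {t} (σ : Fin t → ℕ) h → σ h ≤ ∑[ h < t ] σ h
  σ≤∑σ σ zero    = m≤m+n _ _
  σ≤∑σ σ (suc h) = ≤-trans (σ≤∑σ (λ h → σ (suc h)) h) (m≤n+m _ (σ zero))
classMap-with-sizes (suc n) {t} σ ∑σ≡1+n = c , sizes
  where
  h₀ : Fin t
  h₀ = proj₁ (∑-pos σ (subst (0 <_) (sym ∑σ≡1+n) (s≤s z≤n)))
  δ σ′ : Fin t → ℕ
  δ h = bit (does (h₀ ≟ h))
  σ′ h = σ h ∸ δ h
  σ≡σ′+δ : ∀ h → σ h ≡ σ′ h + δ h
  σ≡σ′+δ h with h₀ ≟ h
  ... | yes refl = sym (m∸n+n≡m (proj₂ (∑-pos σ (subst (0 <_) (sym ∑σ≡1+n) (s≤s z≤n)))))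
  ... | no  _    = sym (+-identityʳ (σ h))
  ∑σ′≡n : ∑[ h < t ] σ′ h ≡ n
  ∑σ′≡n = suc-injective (begin
    suc (∑[ h < t ] σ′ h)                ≡⟨ +-comm 1 _ ⟩
    ∑[ h < t ] σ′ h + 1                  ≡⟨ cong (∑[ h < t ] σ′ h +_) (count-≟ h₀) ⟨
    ∑[ h < t ] σ′ h + ∑[ h < t ] δ h     ≡⟨ ∑-distrib-+ σ′ δ ⟨
    ∑[ h < t ] (σ′ h + δ h)              ≡⟨ sum-cong-≗ {t} σ≡σ′+δ ⟨
    ∑[ h < t ] σ h                       ≡⟨ ∑σ≡1+n ⟩
    suc n                                ∎)
    where open ≡-Reasoning
  rest = classMap-with-sizes n σ′ ∑σ′≡n
  c : Fin (suc n) → Fin t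
  c zero    = h₀
  c (suc i) = proj₁ rest i
  sizes : ∀ h → classSizeᵇ c h ≡ σ h
  sizes h = trans (+-comm (δ h) _) (trans (cong (_+ δ h) (proj₂ rest h)) (sym (σ≡σ′+δ h)))

permutation-between : ∀ {n t} (c c′ : Fin n → Fin t) → (∀ h → classSizeᵇ c h ≡ classSizeᵇ c′ h) →
  Σ (Permutation′ n) λ π → ∀ i → c′ (π ⟨$⟩ʳ i) ≡ c i
permutation-between {zero}      c c′ same = id , λ ()
permutation-between {suc n} {t} c c′ same = lift₀ π′ ∘ₚ τ , λ { zero → c′ⱼ≡c₀ ; (suc i) → proj₂ rest i }
  where
  found = count-pos (λ k → does (c′ k ≟ c zero))
            (subst (0 <_) (same (c zero)) (count-pos⁺ (λ k → does (c k ≟ c zero)) zero (dec-true (c zero ≟ c zero) refl)))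
  j = proj₁ found
  c′ⱼ≡c₀ : c′ j ≡ c zero
  c′ⱼ≡c₀ = does-true⇒ (c′ j ≟ c zero) (proj₂ found)
  τ : Permutation′ (suc n)
  τ = transpose zero j
  d : Fin (suc n) → Fin t
  d k = c′ (τ ⟨$⟩ʳ k)
  same-tail : ∀ h → classSizeᵇ (λ i → c (suc i)) h ≡ classSizeᵇ (λ i → d (suc i)) h
  same-tail h = +-cancelˡ-≡ (bit (does (c zero ≟ h))) _ _ (trans (same h) (trans (sym (classSizeᵇ-permute τ c′ h))
                  (cong (λ x → bit (does (x ≟ h)) + classSizeᵇ (λ i → d (suc i)) h) c′ⱼ≡c₀)))
  rest = permutation-between (λ i → c (suc i)) (λ i → d (suc i)) same-tail
  π′ : Permutation′ n
  π′ = proj₁ rest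

Admissible-cong : ∀ {t} {σ σ′ m : Fin (suc t) → ℕ} → (∀ h → σ h ≡ σ′ h) → Admissible σ m → Admissible σ′ m
Admissible-cong {m = m} σ≗σ′ adm = record
  { bounded     = λ h → subst (m h ≤_) (σ≗σ′ h) (bounded h)
  ; first-below = subst (m zero <_) (σ≗σ′ zero) first-below
  ; below       = λ h h<t → subst (m h <_) (σ≗σ′ h) (below h h<t)
  ; positive    = positive
  }
  where open Admissible adm

module Canonical {n t} (σ m : Fin (suc t) → ℕ) (∑σ≡n : ∑[ h < suc t ] σ h ≡ n) (adm : Admissible σ m) where
  c : Fin n → Fin (suc t)
  c = proj₁ (classMap-with-sizes n σ ∑σ≡n)

  sizes : ∀ h → classSizeᵇ c h ≡ σ h
  sizes = proj₂ (classMap-with-sizes n σ ∑σ≡n)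

  open DominationGame c m (Admissible-cong (λ h → sym (sizes h)) adm) public using (game; complete)

  isomorphic : ∀ {G} (pg : CompleteOneSML (suc t) G) → (∀ h → σ h ≡ classSizeᵇ (proj₁ pg) h) →
    (∀ h → m h ≡ proj₁ (proj₂ (proj₂ pg)) h) → Isomorphic G game
  isomorphic {G} (c′ , cm′ , m′ , sml′ , unique′) σ≗ m≗ = π , λ S →
    trans (cong not (does-⇔ (mk⇔ (⪰-cong S) (⪰-cong′ S)) (m ⪰? profileᵇ c (lookup (img π S))) (m′ ⪰? profileᵇ c′ (lookup S))))
          (sym (CompleteGame.W≡dominationWin G c′ cm′ m′ sml′ unique′ S))
    where
    π-found = permutation-between c′ c (λ h → trans (sym (σ≗ h)) (sym (sizes h)))
    π : Permutation′ n
    π = proj₁ π-found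
    same-profile : ∀ S h → profileᵇ c (lookup (img π S)) h ≡ profileᵇ c′ (lookup S) h
    same-profile S h = trans (profileᵇ-img π c S h) (count-cong (λ i → cong (λ x → _ ∧ does (x ≟ h)) (proj₂ π-found i)))
    ⪰-cong : ∀ S → m ⪰ profileᵇ c (lookup (img π S)) → m′ ⪰ profileᵇ c′ (lookup S)
    ⪰-cong S m⪰ k = subst₂ _≤_ (prefixSum-cong (same-profile S) k) (prefixSum-cong m≗ k) (m⪰ k)
    ⪰-cong′ : ∀ S → m′ ⪰ profileᵇ c′ (lookup S) → m ⪰ profileᵇ c (lookup (img π S))
    ⪰-cong′ S m′⪰ k = subst₂ _≤_ (sym (prefixSum-cong (same-profile S) k)) (sym (prefixSum-cong m≗ k)) (m′⪰ k)

canonical-injective : ∀ {n t} {σ m σ′ m′ : Fin (suc t) → ℕ} (∑σ≡n : ∑[ h < suc t ] σ h ≡ n) (adm : Admissible σ m)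
  (∑σ′≡n : ∑[ h < suc t ] σ′ h ≡ n) (adm′ : Admissible σ′ m′) →
  Isomorphic (Canonical.game σ m ∑σ≡n adm) (Canonical.game σ′ m′ ∑σ′≡n adm′) → (∀ h → σ h ≡ σ′ h) × (∀ h → m h ≡ m′ h)
canonical-injective {σ = σ} {m} {σ′} {m′} ∑σ≡n adm ∑σ′≡n adm′ iso =
  (λ h → trans (sym (Canonical.sizes σ m ∑σ≡n adm h)) (trans (proj₁ same h) (Canonical.sizes σ′ m′ ∑σ′≡n adm′ h))) , proj₂ same
  where
  same = iso⇒same-type {G = Canonical.game σ m ∑σ≡n adm} {Canonical.game σ′ m′ ∑σ′≡n adm′} iso
           (Canonical.complete σ m ∑σ≡n adm) (Canonical.complete σ′ m′ ∑σ′≡n adm′)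

-- Counting isomorphism classes

module _ {n : ℕ} where

  NumIsoClasses-by : ∀ {P : SimpleGame n → Set} {X : Set} (game : X → SimpleGame n) (xs : List X) →
    All (λ x → P (game x)) xs → AllPairs (λ x y → ¬ Isomorphic (game x) (game y)) xs →
    (∀ G → P G → Any (λ x → Isomorphic G (game x)) xs) → NumIsoClasses n P (length xs)
  NumIsoClasses-by game xs all distinct complete =
    map game xs , length-map game xs , All.map⁺ all , AllPairs.map⁺ distinct , λ G pG → Any.map⁺ (complete G pG)

  NumIsoClasses-none : ∀ {P : SimpleGame n → Set} → (∀ G → ¬ P G) → NumIsoClasses n P 0
  NumIsoClasses-none none = [] , refl , All.[] , AllPairs.[] , λ G pG → ⊥-elim (none G pG)

  NumIsoClasses-⊎ : ∀ {P Q : SimpleGame n → Set} {a b} → NumIsoClasses n P a → NumIsoClasses n Q b →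
    (∀ {G H} → P G → Q H → ¬ Isomorphic G H) → NumIsoClasses n (λ G → P G ⊎ Q G) (a + b)
  NumIsoClasses-⊎ (Gs , refl , allP , distinctP , completeP) (Hs , refl , allQ , distinctQ , completeQ) apart =
    Gs ++ Hs , length-++ Gs , All.++⁺ (All.map inj₁ allP) (All.map inj₂ allQ) ,
    AllPairs.++⁺ distinctP distinctQ (All.map (λ pG → All.map (apart pG) allQ) allP) ,
    λ { G (inj₁ pG) → Any.++⁺ˡ (completeP G pG) ; G (inj₂ qG) → Any.++⁺ʳ Gs (completeQ G qG) }

  NumIsoClasses-cong : ∀ {P Q : SimpleGame n → Set} {k} → (∀ G → P G → Q G) → (∀ G → Q G → P G) →
    NumIsoClasses n P k → NumIsoClasses n Q k
  NumIsoClasses-cong P⇒Q Q⇒P (Gs , len , all , distinct , complete) =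
    Gs , len , All.map (P⇒Q _) all , distinct , λ G qG → complete G (Q⇒P G qG)

Composition : ℕ → ℕ → Set
Composition k s = Σ (Fin k → ℕ) λ v → ∑[ i < k ] v i ≡ s

prepend-zero : ∀ {k s} → Composition k s → Composition (suc k) s
prepend-zero (v , ∑v) = (0 ∷ᶠ v) , ∑v

bump : ∀ {k s} → Composition (suc k) s → Composition (suc k) (suc s)
bump (v , ∑v) = (suc (v zero) ∷ᶠ λ i → v (suc i)) , cong suc ∑v

compositions : ∀ k s → List (Composition k s)
compositions zero    zero    = ((λ ()) , refl) ∷ []
compositions zero    (suc s) = []
compositions (suc k) zero    = map prepend-zero (compositions k zero)
compositions (suc k) (suc s) = map prepend-zero (compositions k (suc s)) ++ map bump (compositions (suc k) s)

length-compositions : ∀ k s → length (compositions (suc k) s) ≡ (s + k) C k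
length-compositions k zero    = trans (length-map prepend-zero (compositions k zero)) (trans (length-zero k) (sym (nCn≡1 k)))
  where
  length-zero : ∀ k → length (compositions k zero) ≡ 1
  length-zero zero    = refl
  length-zero (suc k) = trans (length-map prepend-zero (compositions k zero)) (length-zero k)
length-compositions k (suc s) = begin
  length (map prepend-zero (compositions k (suc s)) ++ map bump (compositions (suc k) s))
    ≡⟨ length-++ (map prepend-zero (compositions k (suc s))) ⟩
  length (map prepend-zero (compositions k (suc s))) + length (map bump (compositions (suc k) s))
    ≡⟨ cong₂ _+_ (length-map prepend-zero (compositions k (suc s))) (length-map bump (compositions (suc k) s)) ⟩
  length (compositions k (suc s)) + length (compositions (suc k) s)
    ≡⟨ pascal k ⟩
  (suc s + k) C k ∎
  where
  open ≡-Reasoning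
  pascal : ∀ k → length (compositions k (suc s)) + length (compositions (suc k) s) ≡ (suc s + k) C k
  pascal zero     = trans (length-compositions zero s) (cong (_C 0) (+-identityʳ s))
  pascal (suc k′) = begin
    length (compositions (suc k′) (suc s)) + length (compositions (suc (suc k′)) s)
      ≡⟨ cong₂ _+_ (length-compositions k′ (suc s)) (length-compositions (suc k′) s) ⟩
    (suc s + k′) C k′ + (s + suc k′) C suc k′
      ≡⟨ cong (λ x → (suc s + k′) C k′ + x C suc k′) (+-suc s k′) ⟩
    (suc s + k′) C k′ + (suc s + k′) C suc k′
      ≡⟨ nCk+nC[k+1]≡[n+1]C[k+1] (suc s + k′) k′ ⟩
    suc (suc s + k′) C suc k′
      ≡⟨ cong (λ x → suc x C suc k′) (sym (+-suc s k′)) ⟩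
    (suc s + suc k′) C suc k′ ∎

compositions-complete : ∀ k s (v : Fin k → ℕ) → ∑[ i < k ] v i ≡ s →
  Any (λ x → ∀ i → proj₁ x i ≡ v i) (compositions k s)
compositions-complete zero    zero    v _ = here (λ ())
compositions-complete (suc k) s       v ∑v with v zero in v₀
compositions-complete (suc k) zero    v ∑v | zero =
  Any.map⁺ (Any.map (λ x≗ → λ { zero → sym v₀ ; (suc i) → x≗ i }) (compositions-complete k zero (λ i → v (suc i)) ∑v))
compositions-complete (suc k) (suc s) v ∑v | zero = Any.++⁺ˡ
  (Any.map⁺ (Any.map (λ x≗ → λ { zero → sym v₀ ; (suc i) → x≗ i }) (compositions-complete k (suc s) (λ i → v (suc i)) ∑v)))
compositions-complete (suc k) (suc s) v ∑v | suc a = Any.++⁺ʳ (map prepend-zero (compositions k (suc s)))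
  (Any.map⁺ (Any.map (λ x≗ → λ { zero → trans (cong suc (x≗ zero)) (sym v₀) ; (suc i) → x≗ (suc i) })
    (compositions-complete (suc k) s (a ∷ᶠ λ i → v (suc i)) (suc-injective ∑v))))

compositions-distinct : ∀ k s → AllPairs (λ x y → ¬ (∀ i → proj₁ x i ≡ proj₁ y i)) (compositions k s)
compositions-distinct zero    zero    = All.[] AllPairs.∷ AllPairs.[]
compositions-distinct zero    (suc s) = AllPairs.[]
compositions-distinct (suc k) zero    = AllPairs.map⁺ (AllPairs.map (λ x≉y x≗y → x≉y (λ i → x≗y (suc i))) (compositions-distinct k zero))
compositions-distinct (suc k) (suc s) = AllPairs.++⁺
  (AllPairs.map⁺ (AllPairs.map (λ x≉y x≗y → x≉y (λ i → x≗y (suc i))) (compositions-distinct k (suc s))))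
  (AllPairs.map⁺ (AllPairs.map (λ x≉y x≗y → x≉y (λ { zero → suc-injective (x≗y zero) ; (suc i) → x≗y (suc i) })) (compositions-distinct (suc k) s)))
  (All.tabulate λ x∈ → All.tabulate λ y∈ → zero-vs-bump x∈ y∈)
  where
  zero-vs-bump : ∀ {x y} → x ∈ map prepend-zero (compositions k (suc s)) → y ∈ map bump (compositions (suc k) s) →
    ¬ (∀ i → proj₁ x i ≡ proj₁ y i)
  zero-vs-bump x∈ y∈ x≗y with ∈-map⁻ prepend-zero x∈ | ∈-map⁻ bump y∈
  ... | _ , _ , refl | _ , _ , refl with x≗y zero
  ... | ()

∑-↑ : ∀ a {b} (f : Fin (a + b) → ℕ) → ∑[ i < a + b ] f i ≡ ∑[ i < a ] f (i ↑ˡ b) + ∑[ i < b ] f (a ↑ʳ i)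
∑-↑ zero    f = refl
∑-↑ (suc a) f = trans (cong (f zero +_) (∑-↑ a (λ i → f (suc i)))) (sym (+-assoc (f zero) _ _))

↑-cases : ∀ a {b} (i : Fin (a + b)) → (∃[ j ] j ↑ˡ b ≡ i) ⊎ (∃[ j ] a ↑ʳ j ≡ i)
↑-cases a i with splitAt a i in eq
... | inj₁ j = inj₁ (j , splitAt⁻¹-↑ˡ eq)
... | inj₂ j = inj₂ (j , splitAt⁻¹-↑ʳ eq)

-- Lower bounds for mₕ and for σₕ - mₕ under Admissible.
headGap tailGap : ∀ {t} → Fin (suc t) → ℕ
headGap zero    = 0
headGap (suc _) = 1
tailGap zero        = 1
tailGap {t} (suc h) = bit (suc (toℕ h) <ᵇ t)

minPlayers : ℕ → ℕ
minPlayers t = ∑[ h < suc t ] (headGap h + tailGap h)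

module _ {t} {σ m : Fin (suc t) → ℕ} where

  admissible⇒gaps : Admissible σ m → ∀ h → headGap h ≤ m h × m h + tailGap h ≤ σ h
  admissible⇒gaps adm zero    = z≤n , subst (_≤ σ zero) (+-comm 1 (m zero)) first-below
    where open Admissible adm
  admissible⇒gaps adm (suc h) = positive h , tail
    where
    open Admissible adm
    tail : m (suc h) + bit (suc (toℕ h) <ᵇ t) ≤ σ (suc h)
    tail with suc (toℕ h) <ᵇ t in not-last
    ... | true  = subst (_≤ σ (suc h)) (+-comm 1 _) (below (suc h) (<ᵇ-true⇒< not-last))
    ... | false = subst (_≤ σ (suc h)) (sym (+-identityʳ _)) (bounded (suc h))

  gaps⇒admissible : (∀ h → headGap h ≤ m h) → (∀ h → m h + tailGap h ≤ σ h) → Admissible σ m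
  gaps⇒admissible head≤ tail≤ = record
    { bounded     = λ h → ≤-trans (m≤m+n (m h) _) (tail≤ h)
    ; first-below = subst (_≤ σ zero) (+-comm (m zero) 1) (tail≤ zero)
    ; below       = below
    ; positive    = λ h → head≤ (suc h)
    }
    where
    below : ∀ h → toℕ h < t → m h < σ h
    below zero    _     = subst (_≤ σ zero) (+-comm (m zero) 1) (tail≤ zero)
    below (suc h) h<t   = subst (_≤ σ (suc h)) (trans (cong (λ b → m (suc h) + bit b) (<ᵇ-true h<t)) (+-comm _ 1)) (tail≤ (suc h))

-- Games with t + 1 classes correspond to the compositions g of n - minPlayers t into 2(t + 1)
-- parts: the first half raises m above its lower bounds, the second half raises σ - m.
module Enumeration (n t : ℕ) where
  T : ℕ
  T = suc t

  m-of σ-of : (Fin (T + T) → ℕ) → Fin T → ℕ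
  m-of g h = g (h ↑ˡ T) + headGap h
  σ-of g h = m-of g h + g (T ↑ʳ h) + tailGap h

  ∑σ-of : ∀ g → ∑[ h < T ] σ-of g h ≡ ∑[ i < T + T ] g i + minPlayers t
  ∑σ-of g = begin
    ∑[ h < T ] σ-of g h
      ≡⟨ sum-cong-≗ {T} (λ h → regroup (g (h ↑ˡ T)) (headGap h) (g (T ↑ʳ h)) (tailGap h)) ⟩
    ∑[ h < T ] ((g (h ↑ˡ T) + g (T ↑ʳ h)) + (headGap h + tailGap h))
      ≡⟨ ∑-distrib-+ (λ h → g (h ↑ˡ T) + g (T ↑ʳ h)) (λ h → headGap h + tailGap h) ⟩
    ∑[ h < T ] (g (h ↑ˡ T) + g (T ↑ʳ h)) + minPlayers t
      ≡⟨ cong (_+ minPlayers t) (trans (∑-distrib-+ (λ h → g (h ↑ˡ T)) (λ h → g (T ↑ʳ h))) (sym (∑-↑ T g))) ⟩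
    ∑[ i < T + T ] g i + minPlayers t ∎
    where
    open ≡-Reasoning
    regroup : ∀ a b c d → a + b + c + d ≡ (a + c) + (b + d)
    regroup = solve-∀

  same-parameter : ∀ g g′ → (∀ h → σ-of g h ≡ σ-of g′ h) → (∀ h → m-of g h ≡ m-of g′ h) → ∀ i → g i ≡ g′ i
  same-parameter g g′ same-σ same-m i with ↑-cases T i
  ... | inj₁ (h , refl) = +-cancelʳ-≡ (headGap h) _ _ (same-m h)
  ... | inj₂ (h , refl) = +-cancelˡ-≡ (m-of g h) _ _
        (+-cancelʳ-≡ (tailGap h) _ _ (trans (same-σ h) (cong (λ x → x + g′ (T ↑ʳ h) + tailGap h) (sym (same-m h)))))

  module _ (enough : minPlayers t ≤ n) where

    Parameter : Set
    Parameter = Composition (T + T) (n ∸ minPlayers t)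

    ∑σ≡n : (x : Parameter) → ∑[ h < T ] σ-of (proj₁ x) h ≡ n
    ∑σ≡n (g , ∑g) = trans (∑σ-of g) (trans (cong (_+ minPlayers t) ∑g) (m∸n+n≡m enough))

    admissible : (x : Parameter) → Admissible (σ-of (proj₁ x)) (m-of (proj₁ x))
    admissible (g , _) = gaps⇒admissible (λ h → m≤n+m _ _) (λ h → +-monoˡ-≤ (tailGap h) (m≤m+n _ _))

    game : Parameter → SimpleGame n
    game x = Canonical.game (σ-of (proj₁ x)) (m-of (proj₁ x)) (∑σ≡n x) (admissible x)

    iso⇒same-parameter : ∀ x y → Isomorphic (game x) (game y) → ∀ i → proj₁ x i ≡ proj₁ y i
    iso⇒same-parameter x y iso = same-parameter (proj₁ x) (proj₁ y) (proj₁ same) (proj₂ same)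
      where same = canonical-injective (∑σ≡n x) (admissible x) (∑σ≡n y) (admissible y) iso

    parameters : List Parameter
    parameters = compositions (T + T) (n ∸ minPlayers t)

    parameter-of : ∀ {G} → CompleteOneSML T G → Any (λ x → Isomorphic G (game x)) parameters
    parameter-of {G} pg@(c , cm , m , sml , unique) = Any.map iso-to (compositions-complete (T + T) _ g ∑g)
      where
      gaps = admissible⇒gaps (CompleteGame.admissible G c cm m sml unique)
      g : Fin (T + T) → ℕ
      g = (λ h → m h ∸ headGap h) ++ᶠ (λ h → classSizeᵇ c h ∸ (m h + tailGap h))
      m-of-g : ∀ h → m-of g h ≡ m h
      m-of-g h rewrite splitAt-↑ˡ T h T = m∸n+n≡m (proj₁ (gaps h))
      σ-of-g : ∀ h → σ-of g h ≡ classSizeᵇ c h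
      σ-of-g h rewrite splitAt-↑ʳ T T h = begin
        m-of g h + (classSizeᵇ c h ∸ (m h + tailGap h)) + tailGap h  ≡⟨ cong (λ x → x + (classSizeᵇ c h ∸ (m h + tailGap h)) + tailGap h) (m-of-g h) ⟩
        m h + (classSizeᵇ c h ∸ (m h + tailGap h)) + tailGap h      ≡⟨ regroup (m h) _ (tailGap h) ⟩
        m h + tailGap h + (classSizeᵇ c h ∸ (m h + tailGap h))      ≡⟨ m+[n∸m]≡n (proj₂ (gaps h)) ⟩
        classSizeᵇ c h                                             ∎
        where
        open ≡-Reasoning
        regroup : ∀ a b c → a + b + c ≡ a + c + b
        regroup = solve-∀
      ∑g : ∑[ i < T + T ] g i ≡ n ∸ minPlayers t
      ∑g = trans (sym (m+n∸n≡m (∑[ i < T + T ] g i) (minPlayers t)))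
                 (cong (_∸ minPlayers t) (trans (sym (∑σ-of g)) (trans (sum-cong-≗ {T} σ-of-g) (∑-classSizeᵇ c))))
      iso-to : ∀ {x} → (∀ i → proj₁ x i ≡ g i) → Isomorphic G (game x)
      iso-to {x} x≗g = Canonical.isomorphic (σ-of (proj₁ x)) (m-of (proj₁ x)) (∑σ≡n x) (admissible x) {G} pg
        (λ h → trans (cong₂ (λ a b → a + headGap h + b + tailGap h) (x≗g (h ↑ˡ T)) (x≗g (T ↑ʳ h))) (σ-of-g h))
        (λ h → trans (cong (_+ headGap h) (x≗g (h ↑ˡ T))) (m-of-g h))

    numIsoClasses : NumIsoClasses n (CompleteOneSML T) ((n ∸ minPlayers t + (t + T)) C (t + T))
    numIsoClasses = subst (NumIsoClasses n (CompleteOneSML T)) (length-compositions (t + T) (n ∸ minPlayers t))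
      (NumIsoClasses-by {P = CompleteOneSML T} game parameters
        (All.tabulate (λ {x} _ → Canonical.complete (σ-of (proj₁ x)) (m-of (proj₁ x)) (∑σ≡n x) (admissible x)))
        (AllPairs.map (λ {x} {y} x≉y iso → x≉y (iso⇒same-parameter x y iso)) (compositions-distinct (T + T) (n ∸ minPlayers t)))
        (λ G pG → parameter-of {G} pG))

  enough-players : ∀ {G} → CompleteOneSML T G → minPlayers t ≤ n
  enough-players {G} (c , cm , m , sml , unique) = subst (minPlayers t ≤_) (∑-classSizeᵇ c)
    (∑-mono (λ h → ≤-trans (+-monoˡ-≤ (tailGap h) (proj₁ (gaps h))) (proj₂ (gaps h))))
    where gaps = admissible⇒gaps (CompleteGame.admissible G c cm m sml unique)

-- Binomial sums and the corollary

sumBelow : (ℕ → ℕ) → ℕ → ℕ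
sumBelow f zero    = 0
sumBelow f (suc M) = sumBelow f M + f M

sumBelow-cong : ∀ {f g} M → (∀ j → j < M → f j ≡ g j) → sumBelow f M ≡ sumBelow g M
sumBelow-cong zero    f≗g = refl
sumBelow-cong (suc M) f≗g = cong₂ _+_ (sumBelow-cong M (λ j j<M → f≗g j (m<n⇒m<1+n j<M))) (f≗g M ≤-refl)

sumBelow-+ : ∀ f g M → sumBelow (λ j → f j + g j) M ≡ sumBelow f M + sumBelow g M
sumBelow-+ f g zero    = refl
sumBelow-+ f g (suc M) rewrite sumBelow-+ f g M = interchange (sumBelow f M) (sumBelow g M) (f M) (g M)
  where
  interchange : ∀ a b c d → a + b + (c + d) ≡ a + c + (b + d)
  interchange = solve-∀

sumBelow-head : ∀ f M → sumBelow f (suc M) ≡ f 0 + sumBelow (λ j → f (suc j)) M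
sumBelow-head f zero    = +-comm 0 (f 0)
sumBelow-head f (suc M) = trans (cong (_+ f (suc M)) (sumBelow-head f M)) (+-assoc (f 0) _ _)

sumBelow-pairs : ∀ f M → sumBelow (λ j → f (2 * j) + f (suc (2 * j))) M ≡ sumBelow f (2 * M)
sumBelow-pairs f zero    = refl
sumBelow-pairs f (suc M) = trans (cong (_+ (f (2 * M) + f (suc (2 * M)))) (sumBelow-pairs f M))
  (trans (sym (+-assoc (sumBelow f (2 * M)) _ _)) (cong (sumBelow f) (sym (*-suc 2 M))))

binomial-row : ∀ N R → N < R → sumBelow (N C_) R ≡ 2 ^ N
binomial-row zero    (suc R) _ = trans (sumBelow-head (0 C_) R) (cong suc (sumBelow-zero R))
  where
  sumBelow-zero : ∀ R → sumBelow (λ j → 0 C suc j) R ≡ 0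
  sumBelow-zero zero    = refl
  sumBelow-zero (suc R) = cong (_+ 0) (sumBelow-zero R)
binomial-row (suc N) (suc R) (s≤s N<R) = begin
  sumBelow (suc N C_) (suc R)                                  ≡⟨ sumBelow-head (suc N C_) R ⟩
  1 + sumBelow (λ j → suc N C suc j) R                         ≡⟨ cong (1 +_) (sumBelow-cong R (λ j _ → sym (nCk+nC[k+1]≡[n+1]C[k+1] N j))) ⟩
  1 + sumBelow (λ j → N C j + N C suc j) R                     ≡⟨ cong (1 +_) (sumBelow-+ (N C_) (λ j → N C suc j) R) ⟩
  1 + (sumBelow (N C_) R + sumBelow (λ j → N C suc j) R)       ≡⟨ shuffle (sumBelow (N C_) R) _ ⟩
  sumBelow (N C_) R + (1 + sumBelow (λ j → N C suc j) R)       ≡⟨ cong (sumBelow (N C_) R +_) (sym (sumBelow-head (N C_) R)) ⟩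
  sumBelow (N C_) R + sumBelow (N C_) (suc R)                  ≡⟨ cong₂ _+_ (binomial-row N R N<R) (binomial-row N (suc R) (m<n⇒m<1+n N<R)) ⟩
  2 ^ N + 2 ^ N                                                ≡⟨ cong (2 ^ N +_) (sym (+-identityʳ (2 ^ N))) ⟩
  2 ^ suc N                                                    ∎
  where
  open ≡-Reasoning
  shuffle : ∀ a b → 1 + (a + b) ≡ a + (1 + b)
  shuffle = solve-∀

binomial-odd : ∀ N M → N < 2 * M → sumBelow (λ j → suc N C suc (2 * j)) M ≡ 2 ^ N
binomial-odd N M N<2M = begin
  sumBelow (λ j → suc N C suc (2 * j)) M                ≡⟨ sumBelow-cong M (λ j _ → sym (nCk+nC[k+1]≡[n+1]C[k+1] N (2 * j))) ⟩
  sumBelow (λ j → N C (2 * j) + N C suc (2 * j)) M      ≡⟨ sumBelow-pairs (N C_) M ⟩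
  sumBelow (N C_) (2 * M)                               ≡⟨ binomial-row N (2 * M) N<2M ⟩
  2 ^ N                                                 ∎
  where open ≡-Reasoning

no-classes : ∀ {n} {G : SimpleGame n} → ¬ CompleteOneSML 0 G
no-classes {zero}  {G} _ with trans (sym (empty-los G)) (grand-win G)
... | ()
no-classes {suc n} (c , _) with c zero
... | ()

classes≤players : ∀ {n t} {G : SimpleGame n} → CompleteOneSML t G → t ≤ n
classes≤players {n} {t} (c , (onto , _) , _) = begin
  t                       ≡⟨ sym (count-all {t} {λ _ → true} (λ _ → refl)) ⟩
  ∑[ h < t ] 1            ≤⟨ ∑-mono nonempty ⟩
  ∑[ h < t ] classSizeᵇ c h ≡⟨ ∑-classSizeᵇ c ⟩
  n                       ∎
  where
  open ≤-Reasoning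
  nonempty : ∀ h → 1 ≤ classSizeᵇ c h
  nonempty h = count-pos⁺ _ (proj₁ (onto h)) (trans (cong (λ x → does (x ≟ h)) (proj₂ (onto h))) (dec-true (h ≟ h) refl))

minPlayers-suc : ∀ r → minPlayers (suc r) ≡ suc r + suc r
minPlayers-suc r = cong suc (trans (∑-distrib-+ {suc r} (λ _ → 1) (λ h → bit (toℕ h <ᵇ r)))
  (trans (cong₂ _+_ (count-all {suc r} {λ _ → true} (λ _ → refl)) (below r (suc r) (n≤1+n r))) (sym (+-suc r r))))
  where
  below : ∀ K T → K ≤ T → ∑[ h < T ] bit (toℕ h <ᵇ K) ≡ K
  below zero    T       _         = count-none {T} (λ _ → refl)
  below (suc K) (suc T) (s≤s K≤T) = cong suc (below K T K≤T)

-- The counts of part (2), with the last case absorbed: C(n + 1, 2t - 1) vanishes when 2t > n + 2.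
classCount : ℕ → ℕ → ℕ
classCount n zero          = 0
classCount n (suc zero)    = n
classCount n t@(suc (suc _)) = (n + 1) C (2 * t ∸ 1)

numIsoClasses-classes : ∀ n t → NumIsoClasses n (CompleteOneSML t) (classCount n t)
numIsoClasses-classes n zero = NumIsoClasses-none (λ G → no-classes {G = G})
numIsoClasses-classes n (suc zero) with 1 ≤? n
... | yes 1≤n = subst (NumIsoClasses n (CompleteOneSML 1)) (trans (nC1≡n _) (m∸n+n≡m 1≤n)) (Enumeration.numIsoClasses n 0 1≤n)
... | no  1≰n = subst (NumIsoClasses n (CompleteOneSML 1)) (sym (n≤0⇒n≡0 (≤-pred (≰⇒> 1≰n))))
                  (NumIsoClasses-none (λ G pg → 1≰n (Enumeration.enough-players n 0 {G} pg)))
numIsoClasses-classes n (suc (suc r)) with minPlayers (suc r) ≤? n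
... | yes enough = subst (NumIsoClasses n (CompleteOneSML (suc (suc r)))) (cong₂ _C_ players size)
                     (Enumeration.numIsoClasses n (suc r) enough)
  where
  players : n ∸ minPlayers (suc r) + (suc r + suc (suc r)) ≡ n + 1
  players = begin
    n ∸ minPlayers (suc r) + (suc r + suc (suc r))  ≡⟨ cong (λ L → n ∸ L + (suc r + suc (suc r))) (minPlayers-suc r) ⟩
    n ∸ (suc r + suc r) + (suc r + suc (suc r))     ≡⟨ cong (n ∸ (suc r + suc r) +_) (+-suc (suc r) (suc r)) ⟩
    n ∸ (suc r + suc r) + suc (suc r + suc r)       ≡⟨ +-suc (n ∸ (suc r + suc r)) _ ⟩
    suc (n ∸ (suc r + suc r) + (suc r + suc r))     ≡⟨ cong suc (m∸n+n≡m (subst (_≤ n) (minPlayers-suc r) enough)) ⟩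
    suc n                                           ≡⟨ +-comm 1 n ⟩
    n + 1                                           ∎
    where open ≡-Reasoning
  size : suc r + suc (suc r) ≡ 2 * suc (suc r) ∸ 1
  size = cong (_∸ 1) (lemma r)
    where
    lemma : ∀ r → suc (suc r + suc (suc r)) ≡ 2 * suc (suc r)
    lemma = solve-∀
... | no  too-few = subst (NumIsoClasses n (CompleteOneSML (suc (suc r)))) (sym (k>n⇒nCk≡0 (n+1<2t-1 (≰⇒> too-few))))
                      (NumIsoClasses-none (λ G pg → too-few (Enumeration.enough-players n (suc r) {G} pg)))
  where
  n+1<2t-1 : n < minPlayers (suc r) → n + 1 < 2 * suc (suc r) ∸ 1
  n+1<2t-1 n<L = subst₂ _<_ (+-comm 1 n) (cong (_∸ 1) (lemma r)) (s≤s (subst (n <_) (minPlayers-suc r) n<L))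
    where
    lemma : ∀ r → suc (suc (suc r + suc r)) ≡ 2 * suc (suc r)
    lemma = solve-∀

classCount-beyond : ∀ n r → ¬ 2 * suc (suc r) ≤ n + 2 → classCount n (suc (suc r)) ≡ 0
classCount-beyond n r too-big = k>n⇒nCk≡0
  (subst₂ _<_ (+-comm 1 n) (cong (_∸ 1) (sym (double r))) (s≤s (≤-pred (≤-pred (subst₂ _<_ (+-comm n 2) (double r) (≰⇒> too-big))))))
  where
  double : ∀ r → 2 * suc (suc r) ≡ suc (suc (suc (suc (r + r))))
  double = solve-∀

part2 : ∀ n t → (t ≡ 1 → NumIsoClasses n (CompleteOneSML t) n)
  × (2 ≤ t → 2 * t ≤ n + 2 → NumIsoClasses n (CompleteOneSML t) ((n + 1) C (2 * t ∸ 1)))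
  × (¬ (t ≡ 1) → ¬ (2 ≤ t × 2 * t ≤ n + 2) → NumIsoClasses n (CompleteOneSML t) 0)
part2 n zero          = (λ ()) , (λ ()) , λ _ _ → numIsoClasses-classes n 0
part2 n (suc zero)    = (λ _ → numIsoClasses-classes n 1) , (λ { (s≤s ()) }) , λ t≢1 _ → ⊥-elim (t≢1 refl)
part2 n (suc (suc r)) = (λ ()) , (λ _ _ → numIsoClasses-classes n (suc (suc r))) , λ _ not-many →
  subst (NumIsoClasses n (CompleteOneSML (suc (suc r)))) (classCount-beyond n r (λ fits → not-many (s≤s (s≤s z≤n) , fits)))
        (numIsoClasses-classes n (suc (suc r)))

classes-below : ∀ n T → NumIsoClasses n (λ G → Σ ℕ λ t → t < T × CompleteOneSML t G) (sumBelow (classCount n) T)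
classes-below n zero    = NumIsoClasses-none (λ { G (t , () , _) })
classes-below n (suc T) = NumIsoClasses-cong to from
  (NumIsoClasses-⊎ {P = λ G → Σ ℕ λ t → t < T × CompleteOneSML t G} {Q = CompleteOneSML T}
     (classes-below n T) (numIsoClasses-classes n T) (λ {G} {H} → apart {G} {H}))
  where
  apart : ∀ {G H} → Σ ℕ (λ t → t < T × CompleteOneSML t G) → CompleteOneSML T H → ¬ Isomorphic G H
  apart {G} {H} (t , t<T , pg) ph iso = <-irrefl (iso⇒same-classes {G = G} {H} iso pg ph) t<T
  to : ∀ G → Σ ℕ (λ t → t < T × CompleteOneSML t G) ⊎ CompleteOneSML T G → Σ ℕ λ t → t < suc T × CompleteOneSML t G
  to G (inj₁ (t , t<T , pg)) = t , m<n⇒m<1+n t<T , pg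
  to G (inj₂ pg)             = T , n<1+n T , pg
  from : ∀ G → Σ ℕ (λ t → t < suc T × CompleteOneSML t G) → Σ ℕ (λ t → t < T × CompleteOneSML t G) ⊎ CompleteOneSML T G
  from G (t , t<1+T , pg) with m<1+n⇒m<n∨m≡n t<1+T
  ... | inj₁ t<T  = inj₁ (t , t<T , pg)
  ... | inj₂ refl = inj₂ pg

sum-classCount : ∀ n → sumBelow (classCount n) (suc (suc n)) ≡ 2 ^ n ∸ 1
sum-classCount n = begin
  sumBelow (classCount n) (suc (suc n))                       ≡⟨ sumBelow-head (classCount n) (suc n) ⟩
  sumBelow (λ t → classCount n (suc t)) (suc n)               ≡⟨ sumBelow-head (λ t → classCount n (suc t)) n ⟩
  n + sumBelow (λ r → classCount n (suc (suc r))) n           ≡⟨ cong (_∸ 1) odd ⟨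
  2 ^ n ∸ 1                                                   ∎
  where
  open ≡-Reasoning
  shift : ∀ r → suc n C suc (2 * suc r) ≡ classCount n (suc (suc r))
  shift r = cong₂ _C_ (+-comm 1 n) (cong (_∸ 1) (lemma r))
    where
    lemma : ∀ r → suc (suc (2 * suc r)) ≡ 2 * suc (suc r)
    lemma = solve-∀
  odd : 2 ^ n ≡ suc (n + sumBelow (λ r → classCount n (suc (suc r))) n)
  odd = begin
    2 ^ n                                                            ≡⟨ binomial-odd n (suc n) (≤-trans (n<1+n n) (m≤m+n (suc n) _)) ⟨
    sumBelow (λ j → suc n C suc (2 * j)) (suc n)                    ≡⟨ sumBelow-head (λ j → suc n C suc (2 * j)) n ⟩
    suc n C 1 + sumBelow (λ r → suc n C suc (2 * suc r)) n          ≡⟨ cong₂ _+_ (nC1≡n (suc n)) (sumBelow-cong n (λ r _ → shift r)) ⟩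
    suc (n + sumBelow (λ r → classCount n (suc (suc r))) n)         ∎

part1 : ∀ n → NumIsoClasses n (λ G → ∃[ t ] CompleteOneSML t G) (2 ^ n ∸ 1)
part1 n = subst (NumIsoClasses n (λ G → ∃[ t ] CompleteOneSML t G)) (sum-classCount n)
  (NumIsoClasses-cong (λ G (t , _ , pg) → t , pg) (λ G (t , pg) → t , s≤s (≤-trans (classes≤players {G = G} pg) (n≤1+n n)) , pg)
    (classes-below n (suc (suc n))))

corollary5p3 : (n : ℕ) →
    NumIsoClasses n (λ G → ∃[ t ] CompleteOneSML t G) (2 ^ n ∸ 1)
    × (∀ t → (t ≡ 1 → NumIsoClasses n (CompleteOneSML t) n)
           × (2 ≤ t → 2 * t ≤ n + 2 → NumIsoClasses n (CompleteOneSML t) ((n + 1) C (2 * t ∸ 1)))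
           × (¬ (t ≡ 1) → ¬ (2 ≤ t × 2 * t ≤ n + 2) → NumIsoClasses n (CompleteOneSML t) 0))
corollary5p3 n = part1 n , part2 n
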